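{- Let $j$ be a non-negative integer and $m$ a positive integer. For $|q|<1$, and for either choice of sign (upper signs throughout, or lower signs throughout), \begin{enumerate} \item[(i)] $\displaystyle V^{\pm}_{j,m}(q) = (\pm q;q)_m^2 \sum_{k=j}^\infty (\pm 1)^{k-j} B_{k,j}\,q^k\,H_{k,m}(q,q^2)$; \item[(ii)] $\displaystyle W^{\pm}_{j,m}(q) = (\pm q;q^2)^2_m \sum_{k=j}^\infty (\pm 1)^{k-j} B_{k,j}\,q^k\,H_{k,m}(q^2,q^2)$. \end{enumerate}
   Context: For $n\ge 0$, $(a;q)_n=\prod_{r=0}^{n-1}(1-aq^r)$ with $(a;q)_0=1$. For integers $m,k$ and a base $p$, the Gaussian polynomial is ${m \brack k}_p=\frac{(p;p)_m}{(p;p)_k(p;p)_{m-k}}$ if $0\le k\le m$ and $0$ otherwise. For non-negative integers $k,m$ define $$V^{\pm}_{k,m}(q)=\sum_{1\le n_1\le n_2\le\cdots\le n_k\le m}\prod_{i=1}^k\frac{q^{n_i}}{(1\mp q^{n_i})^2},\qquad W^{\pm}_{k,m}(q)=\sum_{1\le n_1\le\cdots\le n_k\le m}\prod_{i=1}^k\frac{q^{2n_i-1}}{(1\mp q^{2n_i-1})^2},$$ with $V^{\pm}_{0,m}(q)=W^{\pm}_{0,m}(q)=1$. Define $$H_{k,m}(p,z)=\sum_{i=0}^\infty {m-1+i \brack i}_p {m-1+k+i \brack k+i}_p z^{i}.$$ The coefficients $B_{k,j}$ (for $k\ge j\ge 0$) are $B_{0,0}=1$, $B_{k,0}=2$ for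 $k\ge1$, and $B_{k,j}=\frac{2k}{k+j}\binom{k+j}{2j}$ for $j\ge1$, $k\ge j$. -}

module Defs where

open import Data.Bool using (Bool; true; false; if_then_else_)
open import Data.Nat as ℕ using (ℕ; zero; suc; _∸_; _≤ᵇ_; _≡ᵇ_)
import Data.Nat.DivMod as ND
import Data.Nat.Combinatorics as NC
open import Relation.Binary.PropositionalEquality using (_≡_)
open import Data.Integer as ℤ using (ℤ; +_; _+_; _*_; -_; _-_; _^_)

-- Formal power series in q with integer coefficients:
-- f n is the coefficient of q^n.

PS : Set
PS = ℕ → ℤ

_≐_ : PS → PS → Set
f ≐ g = ∀ n → f n ≡ g n
infix 4 _≐_

sumTo : ℕ → (ℕ → ℤ) → ℤ
sumTo zero    f = f 0
sumTo (suc n) f = sumTo n f + f (suc n)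

0ₚ : PS
0ₚ _ = + 0

1ₚ : PS
1ₚ zero    = + 1
1ₚ (suc _) = + 0

mono : ℕ → PS
mono a n = if a ≡ᵇ n then + 1 else + 0

_+ₚ_ : PS → PS → PS
(f +ₚ g) n = f n + g n

_-ₚ_ : PS → PS → PS
(f -ₚ g) n = f n - g n

_*ₚ_ : PS → PS → PS
(f *ₚ g) n = sumTo n (λ i → f i * g (n ∸ i))

infixl 6 _+ₚ_ _-ₚ_
infixl 7 _*ₚ_

scale : ℤ → PS → PS
scale c f n = c * f n

_^ₚ_ : PS → ℕ → PS
f ^ₚ zero  = 1ₚ
f ^ₚ suc k = f *ₚ (f ^ₚ k)

-- q-adically convergent infinite sum Σ_{k≥0} F k, valid when the k-th
-- term F k is divisible by q^k (only k ≤ n contribute to the coefficient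
-- of q^n).  All uses below satisfy this.
qsum : (ℕ → PS) → PS
qsum F n = sumTo n (λ k → F k n)

-- multiplicative inverse of a power series with constant term 1:
-- 1/f = Σ_{k≥0} (1 - f)^k  (1 - f is divisible by q).
-- Only applied to series with constant term 1.
inv : PS → PS
inv f = qsum (λ k → (1ₚ -ₚ f) ^ₚ k)

prodBelow : ℕ → (ℕ → PS) → PS
prodBelow zero    g = 1ₚ
prodBelow (suc n) g = prodBelow n g *ₚ g n

sum1 : ℕ → (ℕ → PS) → PS
sum1 zero    g = 0ₚ
sum1 (suc m) g = sum1 m g +ₚ g (suc m)

qPoch : PS → PS → ℕ → PS
qPoch a b n = prodBelow n (λ r → 1ₚ -ₚ a *ₚ (b ^ₚ r))

gauss : PS → ℕ → ℕ → PS
gauss p m k =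
  if k ≤ᵇ m
  then qPoch p p m *ₚ inv (qPoch p p k) *ₚ inv (qPoch p p (m ∸ k))
  else 0ₚ

-- H_{k,m}(p,z) = Σ_{i≥0} [m-1+i, i]_p [m-1+k+i, k+i]_p z^i
-- (used with z = q^2, so the i-th term is divisible by q^i)
H : ℕ → ℕ → PS → PS → PS
H k m p z = qsum (λ i → gauss p (m ∸ 1 ℕ.+ i) i *ₚ gauss p (m ∸ 1 ℕ.+ k ℕ.+ i) (k ℕ.+ i) *ₚ (z ^ₚ i))

-- B_{0,0} = 1, B_{k,0} = 2 (k ≥ 1), B_{k,j} = 2k/(k+j) binom(k+j,2j) (j ≥ 1);
-- for j = suc j' the divisor k + j equals suc (k + j'); the division is exact.
B : ℕ → ℕ → ℕ
B zero    zero     = 1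
B (suc k) zero     = 2
B k       (suc j') = (2 ℕ.* k ℕ.* (NC._C_ (k ℕ.+ suc j') (2 ℕ.* suc j'))) ND./ suc (k ℕ.+ j')

-- The sign ± is encoded by ε ∈ {1, -1}.

q : PS
q = mono 1

-- V^±_{k,m}(q) = Σ_{1≤n_1≤…≤n_k≤m} Π q^{n_i}/(1 ∓ q^{n_i})^2,
-- written by splitting off the largest index n_k.
Vterm : ℤ → ℕ → PS
Vterm ε n = mono n *ₚ inv ((1ₚ -ₚ scale ε (mono n)) ^ₚ 2)

V : ℤ → ℕ → ℕ → PS
V ε zero    m = 1ₚ
V ε (suc k) m = sum1 m (λ n → Vterm ε n *ₚ V ε k n)

-- W^±_{k,m}(q) = Σ_{1≤n_1≤…≤n_k≤m} Π q^{2n_i-1}/(1 ∓ q^{2n_i-1})^2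
Wterm : ℤ → ℕ → PS
Wterm ε n = mono (2 ℕ.* n ∸ 1) *ₚ inv ((1ₚ -ₚ scale ε (mono (2 ℕ.* n ∸ 1))) ^ₚ 2)

W : ℤ → ℕ → ℕ → PS
W ε zero    m = 1ₚ
W ε (suc k) m = sum1 m (λ n → Wterm ε n *ₚ W ε k n)

Sser : ℤ → ℕ → ℕ → PS → PS → PS
Sser ε j m p z = qsum (λ k →
  if j ≤ᵇ k
  then scale ((ε ^ (k ∸ j)) * + (B k j)) (mono k *ₚ H k m p z)
  else 0ₚ)

{-# OPTIONS --safe #-}
module Submission where

-- Write x_m = y pᵐ for an indeterminate y, d_{m,a} = [m-1+a, a]_p yᵃ and
-- c_{m,k} = Σᵢ d_{m,i} d_{m,k+i}, so that c_{m,k} = (±q)ᵏ H_{k,m}(p, q²) for y = ±q.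
-- The q-Pascal rule d_{m,a} = d_{m+1,a} - x_m d_{m+1,a-1} gives
--   c_{m,k} = (1 + x_m²) c_{m+1,k} - x_m (c_{m+1,k+1} + c_{m+1,k-1}),  c_{m,-1} = c_{m,1},
-- and B_{k+1,j} + B_{k-1,j} = 2 B_{k,j} + B_{k,j-1} (Pascal's rule for
-- B_{k,j} = C(k+j,2j) + C(k+j-1,2j), adjusted at k ≤ 1 to the reflection c_{-1} = c_1).
-- Together they make U_{m,j} = Σₖ B_{k,j} c_{m,k} satisfy
--   (1 - x_m)² U_{m+1,j} = U_{m,j} + x_m U_{m+1,j-1},
-- so (y;p)_m² U_{m,j} obeys the recursion in m of the chain sums
-- Σ_{1≤n₁≤⋯≤n_j≤m} Πᵢ x_{nᵢ-1}/(1 - x_{nᵢ-1})², and both equal δ_{j,0} at m = 0.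
-- For y = ±q these chain sums are (±1)ʲ V^±_{j,m} (p = q) and (±1)ʲ W^±_{j,m} (p = q²),
-- and Σₖ B_{k,j} c_{m,k} is (±1)ʲ times the series on the right of the theorem.

open import Defs
open import Level using (0ℓ)
open import Data.Bool as Bool using (true; false; if_then_else_)
open import Data.Maybe using (Maybe; just; nothing)
open import Data.Nat as ℕ using (ℕ; zero; suc; _∸_; _≤_; _<_; z≤n; s≤s; _≤ᵇ_)
import Data.Nat.Properties as ℕₚ
open import Data.Nat.Combinatorics using (_C_; nCk+nC[k+1]≡[n+1]C[k+1]; k>n⇒nCk≡0; nC1≡n)
import Data.Nat.DivMod as ℕ
import Data.Nat.Tactic.RingSolver as ℕ-Solver
open import Data.Integer as ℤ using (ℤ; +_; _+_; _*_; -_; _-_; _^_)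
import Data.Integer.Properties as ℤₚ
import Data.Integer.Tactic.RingSolver as ℤ-Solver
open import Data.Product using (_×_; _,_)
open import Data.Sum using (_⊎_; inj₁; inj₂)
open import Relation.Nullary using (yes; no)
open import Relation.Binary.PropositionalEquality
open import Algebra.Bundles using (CommutativeRing)
import Algebra.Solver.Ring.AlmostCommutativeRing as ACR
import Relation.Binary.Reasoning.Setoid as SetoidReasoning

sumTo-cong : ∀ n {f g : ℕ → ℤ} → (∀ i → i ≤ n → f i ≡ g i) → sumTo n f ≡ sumTo n g
sumTo-cong zero    f≡g = f≡g 0 z≤n
sumTo-cong (suc n) f≡g =
  cong₂ _+_ (sumTo-cong n (λ i i≤n → f≡g i (ℕₚ.m≤n⇒m≤1+n i≤n))) (f≡g (suc n) ℕₚ.≤-refl)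

sumTo-+ : ∀ n (f g : ℕ → ℤ) → sumTo n (λ i → f i + g i) ≡ sumTo n f + sumTo n g
sumTo-+ zero    f g = refl
sumTo-+ (suc n) f g rewrite sumTo-+ n f g = interchange (sumTo n f) (sumTo n g) (f (suc n)) (g (suc n))
  where
  interchange : ∀ a b c d → a + b + (c + d) ≡ a + c + (b + d)
  interchange = ℤ-Solver.solve-∀

sumTo-*ˡ : ∀ n c (f : ℕ → ℤ) → sumTo n (λ i → c * f i) ≡ c * sumTo n f
sumTo-*ˡ zero    c f = refl
sumTo-*ˡ (suc n) c f rewrite sumTo-*ˡ n c f = sym (ℤₚ.*-distribˡ-+ c (sumTo n f) (f (suc n)))

sumTo-*ʳ : ∀ n c (f : ℕ → ℤ) → sumTo n (λ i → f i * c) ≡ sumTo n f * c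
sumTo-*ʳ zero    c f = refl
sumTo-*ʳ (suc n) c f rewrite sumTo-*ʳ n c f = sym (ℤₚ.*-distribʳ-+ c (sumTo n f) (f (suc n)))

sumTo-neg : ∀ n (f : ℕ → ℤ) → sumTo n (λ i → - f i) ≡ - sumTo n f
sumTo-neg zero    f = refl
sumTo-neg (suc n) f rewrite sumTo-neg n f = sym (ℤₚ.neg-distrib-+ (sumTo n f) (f (suc n)))

sumTo-zero : ∀ n (f : ℕ → ℤ) → (∀ i → i ≤ n → f i ≡ + 0) → sumTo n f ≡ + 0
sumTo-zero n f f≡0 = trans (sumTo-cong n f≡0) (sum-of-zeros n)
  where
  sum-of-zeros : ∀ n → sumTo n (λ _ → + 0) ≡ + 0
  sum-of-zeros zero    = refl
  sum-of-zeros (suc n) rewrite sum-of-zeros n = refl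

sumTo-head : ∀ n (f : ℕ → ℤ) → sumTo (suc n) f ≡ f 0 + sumTo n (λ i → f (suc i))
sumTo-head zero    f = refl
sumTo-head (suc n) f rewrite sumTo-head n f = ℤₚ.+-assoc (f 0) _ _

sumTo-extend : ∀ n N (f : ℕ → ℤ) → n ≤ N → (∀ i → n < i → f i ≡ + 0) → sumTo N f ≡ sumTo n f
sumTo-extend n N f n≤N f≡0 =
  trans (cong (λ t → sumTo t f) (sym (ℕₚ.m+[n∸m]≡n n≤N))) (padding (N ∸ n))
  where
  padding : ∀ k → sumTo (n ℕ.+ k) f ≡ sumTo n f
  padding zero rewrite ℕₚ.+-identityʳ n = refl
  padding (suc k) rewrite ℕₚ.+-suc n k | padding k | f≡0 (suc (n ℕ.+ k)) (s≤s (ℕₚ.m≤m+n n k)) =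
    ℤₚ.+-identityʳ _

sumTo-swap : ∀ n m (f : ℕ → ℕ → ℤ) →
  sumTo n (λ i → sumTo m (λ j → f i j)) ≡ sumTo m (λ j → sumTo n (λ i → f i j))
sumTo-swap zero    m f = refl
sumTo-swap (suc n) m f rewrite sumTo-swap n m f =
  sym (sumTo-+ m (λ j → sumTo n (λ i → f i j)) (λ j → f (suc n) j))

sumTo-reverse : ∀ n (f : ℕ → ℤ) → sumTo n f ≡ sumTo n (λ i → f (n ∸ i))
sumTo-reverse zero    f = refl
sumTo-reverse (suc n) f = begin
  sumTo n f + f (suc n)                      ≡⟨ cong (_+ f (suc n)) (sumTo-reverse n f) ⟩
  sumTo n (λ i → f (n ∸ i)) + f (suc n)      ≡⟨ ℤₚ.+-comm _ (f (suc n)) ⟩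
  f (suc n) + sumTo n (λ i → f (n ∸ i))      ≡⟨ sym (sumTo-head n (λ i → f (suc n ∸ i))) ⟩
  sumTo (suc n) (λ i → f (suc n ∸ i))        ∎
  where open ≡-Reasoning

sumTo-triangle : ∀ n (f : ℕ → ℕ → ℤ) →
  sumTo n (λ i → sumTo i (λ a → f a i)) ≡ sumTo n (λ a → sumTo (n ∸ a) (λ b → f a (a ℕ.+ b)))
sumTo-triangle zero    f = refl
sumTo-triangle (suc n) f = begin
    sumTo n (λ i → sumTo i (λ a → f a i)) + sumTo (suc n) (λ a → f a (suc n))
  ≡⟨ cong (_+ sumTo (suc n) (λ a → f a (suc n))) (sumTo-triangle n f) ⟩
    R + (sumTo n (λ a → f a (suc n)) + f (suc n) (suc n))
  ≡⟨ sym (ℤₚ.+-assoc R _ _) ⟩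
    R + sumTo n (λ a → f a (suc n)) + f (suc n) (suc n)
  ≡⟨ cong (_+ f (suc n) (suc n)) (sym (sumTo-+ n _ _)) ⟩
    sumTo n (λ a → sumTo (n ∸ a) (λ b → f a (a ℕ.+ b)) + f a (suc n)) + f (suc n) (suc n)
  ≡⟨ cong₂ _+_ (sumTo-cong n row) (cong (f (suc n)) (sym (ℕₚ.+-identityʳ (suc n)))) ⟩
    sumTo n (λ a → sumTo (suc n ∸ a) (λ b → f a (a ℕ.+ b))) + f (suc n) (suc n ℕ.+ 0)
  ≡⟨ cong (λ t → sumTo n (λ a → sumTo (suc n ∸ a) (λ b → f a (a ℕ.+ b)))
                 + sumTo t (λ b → f (suc n) (suc n ℕ.+ b))) (sym (ℕₚ.n∸n≡0 n)) ⟩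
    sumTo (suc n) (λ a → sumTo (suc n ∸ a) (λ b → f a (a ℕ.+ b)))
  ∎
  where
  open ≡-Reasoning
  R = sumTo n (λ a → sumTo (n ∸ a) (λ b → f a (a ℕ.+ b)))
  row : ∀ a → a ≤ n → sumTo (n ∸ a) (λ b → f a (a ℕ.+ b)) + f a (suc n)
                    ≡ sumTo (suc n ∸ a) (λ b → f a (a ℕ.+ b))
  row a a≤n rewrite ℕₚ.+-∸-assoc 1 a≤n =
    cong (λ t → sumTo (n ∸ a) (λ b → f a (a ℕ.+ b)) + f a t)
      (trans (cong suc (sym (ℕₚ.m+[n∸m]≡n a≤n))) (sym (ℕₚ.+-suc a (n ∸ a))))

-- The ring of power series

≐-refl : ∀ {f} → f ≐ f
≐-refl n = refl

≐-sym : ∀ {f g} → f ≐ g → g ≐ f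
≐-sym f≐g n = sym (f≐g n)

≐-trans : ∀ {f g h} → f ≐ g → g ≐ h → f ≐ h
≐-trans f≐g g≐h n = trans (f≐g n) (g≐h n)

≡⇒≐ : ∀ {f g} → f ≡ g → f ≐ g
≡⇒≐ refl = ≐-refl

cong≐ : ∀ {A : Set} (F : A → PS) {a b : A} → a ≡ b → F a ≐ F b
cong≐ F a≡b = ≡⇒≐ (cong F a≡b)

negₚ : PS → PS
negₚ f n = - f n

+ₚ-cong : ∀ {f f′ g g′} → f ≐ f′ → g ≐ g′ → f +ₚ g ≐ f′ +ₚ g′
+ₚ-cong f≐ g≐ n = cong₂ _+_ (f≐ n) (g≐ n)

negₚ-cong : ∀ {f f′} → f ≐ f′ → negₚ f ≐ negₚ f′
negₚ-cong f≐ n = cong -_ (f≐ n)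

-ₚ-cong : ∀ {f f′ g g′} → f ≐ f′ → g ≐ g′ → f -ₚ g ≐ f′ -ₚ g′
-ₚ-cong f≐ g≐ n = cong₂ _-_ (f≐ n) (g≐ n)

*ₚ-cong : ∀ {f f′ g g′} → f ≐ f′ → g ≐ g′ → f *ₚ g ≐ f′ *ₚ g′
*ₚ-cong f≐ g≐ n = sumTo-cong n (λ i _ → cong₂ _*_ (f≐ i) (g≐ (n ∸ i)))

*ₚ-comm : ∀ f g → f *ₚ g ≐ g *ₚ f
*ₚ-comm f g n = trans (sumTo-reverse n _) (sumTo-cong n (λ i i≤n →
  trans (cong (λ t → f (n ∸ i) * g t) (ℕₚ.m∸[m∸n]≡n i≤n)) (ℤₚ.*-comm (f (n ∸ i)) (g i))))

*ₚ-assoc : ∀ f g h → (f *ₚ g) *ₚ h ≐ f *ₚ (g *ₚ h)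
*ₚ-assoc f g h n = begin
    sumTo n (λ i → sumTo i (λ a → f a * g (i ∸ a)) * h (n ∸ i))
  ≡⟨ sumTo-cong n (λ i _ → sym (sumTo-*ʳ i (h (n ∸ i)) _)) ⟩
    sumTo n (λ i → sumTo i (λ a → f a * g (i ∸ a) * h (n ∸ i)))
  ≡⟨ sumTo-triangle n (λ a i → f a * g (i ∸ a) * h (n ∸ i)) ⟩
    sumTo n (λ a → sumTo (n ∸ a) (λ b → f a * g (a ℕ.+ b ∸ a) * h (n ∸ (a ℕ.+ b))))
  ≡⟨ sumTo-cong n (λ a _ → trans (sumTo-cong (n ∸ a) (λ b _ →
        trans (ℤₚ.*-assoc (f a) _ _)
          (cong₂ (λ u v → f a * (g u * h v)) (ℕₚ.m+n∸m≡n a b) (sym (ℕₚ.∸-+-assoc n a b)))))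
       (sumTo-*ˡ (n ∸ a) (f a) _)) ⟩
    sumTo n (λ a → f a * sumTo (n ∸ a) (λ b → g b * h (n ∸ a ∸ b)))
  ∎
  where open ≡-Reasoning

*ₚ-distribʳ : ∀ h f g → (f +ₚ g) *ₚ h ≐ f *ₚ h +ₚ g *ₚ h
*ₚ-distribʳ h f g n =
  trans (sumTo-cong n (λ i _ → ℤₚ.*-distribʳ-+ (h (n ∸ i)) (f i) (g i))) (sumTo-+ n _ _)

*ₚ-distribˡ : ∀ h f g → h *ₚ (f +ₚ g) ≐ h *ₚ f +ₚ h *ₚ g
*ₚ-distribˡ h f g = ≐-trans (*ₚ-comm h (f +ₚ g))
  (≐-trans (*ₚ-distribʳ h f g) (+ₚ-cong (*ₚ-comm f h) (*ₚ-comm g h)))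

*ₚ-identityˡ : ∀ f → 1ₚ *ₚ f ≐ f
*ₚ-identityˡ f zero    = ℤₚ.*-identityˡ (f 0)
*ₚ-identityˡ f (suc n) = trans (sumTo-head n _) (trans
  (cong₂ _+_ (ℤₚ.*-identityˡ (f (suc n))) (sumTo-zero n _ (λ i _ → ℤₚ.*-zeroˡ (f (n ∸ i)))))
  (ℤₚ.+-identityʳ _))

*ₚ-identityʳ : ∀ f → f *ₚ 1ₚ ≐ f
*ₚ-identityʳ f = ≐-trans (*ₚ-comm f 1ₚ) (*ₚ-identityˡ f)

PS-commutativeRing : CommutativeRing 0ℓ 0ℓ
PS-commutativeRing = record
  { Carrier = PS
  ; _≈_ = _≐_
  ; _+_ = _+ₚ_
  ; _*_ = _*ₚ_
  ; -_ = negₚ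
  ; 0# = 0ₚ
  ; 1# = 1ₚ
  ; isCommutativeRing = record
    { isRing = record
      { +-isAbelianGroup = record
        { isGroup = record
          { isMonoid = record
            { isSemigroup = record
              { isMagma = record
                { isEquivalence = record { refl = ≐-refl ; sym = ≐-sym ; trans = ≐-trans }
                ; ∙-cong = +ₚ-cong }
              ; assoc = λ f g h n → ℤₚ.+-assoc (f n) (g n) (h n) }
            ; identity = (λ f n → ℤₚ.+-identityˡ (f n)) , (λ f n → ℤₚ.+-identityʳ (f n)) }
          ; inverse = (λ f n → ℤₚ.+-inverseˡ (f n)) , (λ f n → ℤₚ.+-inverseʳ (f n))
          ; ⁻¹-cong = negₚ-cong }
        ; comm = λ f g n → ℤₚ.+-comm (f n) (g n) }
      ; *-cong = *ₚ-cong
      ; *-assoc = *ₚ-assoc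
      ; *-identity = *ₚ-identityˡ , *ₚ-identityʳ
      ; distrib = *ₚ-distribˡ , *ₚ-distribʳ }
    ; *-comm = *ₚ-comm }
  }

module ≐-Reasoning = SetoidReasoning (CommutativeRing.setoid PS-commutativeRing)

*ₚ-congˡ : ∀ {f f′} g → f ≐ f′ → f *ₚ g ≐ f′ *ₚ g
*ₚ-congˡ g f≐ = *ₚ-cong f≐ (≐-refl {g})

*ₚ-congʳ : ∀ f {g g′} → g ≐ g′ → f *ₚ g ≐ f *ₚ g′
*ₚ-congʳ f g≐ = *ₚ-cong (≐-refl {f}) g≐

+ₚ-congˡ : ∀ {f f′} g → f ≐ f′ → f +ₚ g ≐ f′ +ₚ g
+ₚ-congˡ g f≐ = +ₚ-cong f≐ (≐-refl {g})

+ₚ-congʳ : ∀ f {g g′} → g ≐ g′ → f +ₚ g ≐ f +ₚ g′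
+ₚ-congʳ f g≐ = +ₚ-cong (≐-refl {f}) g≐

^ₚ-cong : ∀ {f g} k → f ≐ g → f ^ₚ k ≐ g ^ₚ k
^ₚ-cong zero    f≐g = ≐-refl
^ₚ-cong (suc k) f≐g = *ₚ-cong f≐g (^ₚ-cong k f≐g)

constₚ : ℤ → PS
constₚ c zero    = c
constₚ c (suc n) = + 0

constₚ-*ₚ : ∀ c f → constₚ c *ₚ f ≐ scale c f
constₚ-*ₚ c f zero    = refl
constₚ-*ₚ c f (suc n) = trans (sumTo-head n _) (trans
  (cong (λ t → c * f (suc n) + t) (sumTo-zero n _ (λ i _ → ℤₚ.*-zeroˡ (f (n ∸ i)))))
  (ℤₚ.+-identityʳ _))

constₚ-* : ∀ a b → constₚ (a * b) ≐ constₚ a *ₚ constₚ b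
constₚ-* a b = ≐-sym (≐-trans (constₚ-*ₚ a (constₚ b)) scaled)
  where
  scaled : scale a (constₚ b) ≐ constₚ (a * b)
  scaled zero    = refl
  scaled (suc n) = ℤₚ.*-zeroʳ a

constₚ-+ : ∀ a b → constₚ (a + b) ≐ constₚ a +ₚ constₚ b
constₚ-+ a b zero    = refl
constₚ-+ a b (suc n) = refl

constₚ-neg : ∀ a → constₚ (- a) ≐ negₚ (constₚ a)
constₚ-neg a zero    = refl
constₚ-neg a (suc n) = refl

constₚ-1 : constₚ (+ 1) ≐ 1ₚ
constₚ-1 zero    = refl
constₚ-1 (suc n) = refl

constₚ-^ₚ : ∀ a n → constₚ a ^ₚ n ≐ constₚ (a ^ n)
constₚ-^ₚ a zero    = ≐-sym constₚ-1
constₚ-^ₚ a (suc n) = ≐-trans (*ₚ-congʳ (constₚ a) (constₚ-^ₚ a n)) (≐-sym (constₚ-* a (a ^ n)))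

-- The solver interprets its integer constants by constₚ′, which sends
-- 0 and 1 to 0ₚ and 1ₚ themselves so that solved goals match them literally.
constₚ′ : ℤ → PS
constₚ′ (+ 0) = 0ₚ
constₚ′ (+ 1) = 1ₚ
constₚ′ c     = constₚ c

constₚ′≐constₚ : ∀ c → constₚ′ c ≐ constₚ c
constₚ′≐constₚ (+ 0)          zero    = refl
constₚ′≐constₚ (+ 0)          (suc n) = refl
constₚ′≐constₚ (+ 1)          zero    = refl
constₚ′≐constₚ (+ 1)          (suc n) = refl
constₚ′≐constₚ (+ suc (suc k)) n      = refl
constₚ′≐constₚ ℤ.-[1+ k ]      n      = refl

private
  PS-almostCommutativeRing : ACR.AlmostCommutativeRing 0ℓ 0ℓ
  PS-almostCommutativeRing = ACR.fromCommutativeRing PS-commutativeRing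

  constₚ′-homomorphism : ACR._-Raw-AlmostCommutative⟶_
    (CommutativeRing.rawRing ℤₚ.+-*-commutativeRing) PS-almostCommutativeRing
  constₚ′-homomorphism = record
    { ⟦_⟧    = constₚ′
    ; +-homo = λ a b → ≐-trans (constₚ′≐constₚ (a + b))
                (≐-trans (constₚ-+ a b) (≐-sym (+ₚ-cong (constₚ′≐constₚ a) (constₚ′≐constₚ b))))
    ; *-homo = λ a b → ≐-trans (constₚ′≐constₚ (a * b))
                (≐-trans (constₚ-* a b) (≐-sym (*ₚ-cong (constₚ′≐constₚ a) (constₚ′≐constₚ b))))
    ; -‿homo = λ a → ≐-trans (constₚ′≐constₚ (- a))
                (≐-trans (constₚ-neg a) (≐-sym (negₚ-cong (constₚ′≐constₚ a))))
    ; 0-homo = ≐-refl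
    ; 1-homo = ≐-refl
    }

  constₚ′-equal? : ∀ a b → Maybe (constₚ′ a ≐ constₚ′ b)
  constₚ′-equal? a b with a ℤₚ.≟ b
  ... | yes refl = just ≐-refl
  ... | no _     = nothing

open import Algebra.Solver.Ring (CommutativeRing.rawRing ℤₚ.+-*-commutativeRing)
  PS-almostCommutativeRing constₚ′-homomorphism constₚ′-equal?
  using (solve; _:=_; _:+_; _:*_; _:-_; :-_; _:^_; con)

^ₚ-+ : ∀ f a b → f ^ₚ (a ℕ.+ b) ≐ f ^ₚ a *ₚ f ^ₚ b
^ₚ-+ f zero    b = ≐-sym (*ₚ-identityˡ _)
^ₚ-+ f (suc a) b = ≐-trans (*ₚ-congʳ f (^ₚ-+ f a b)) (≐-sym (*ₚ-assoc f (f ^ₚ a) (f ^ₚ b)))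

^ₚ-distrib-*ₚ : ∀ f g k → (f *ₚ g) ^ₚ k ≐ f ^ₚ k *ₚ g ^ₚ k
^ₚ-distrib-*ₚ f g zero    = ≐-sym (*ₚ-identityˡ 1ₚ)
^ₚ-distrib-*ₚ f g (suc k) = ≐-trans (*ₚ-congʳ (f *ₚ g) (^ₚ-distrib-*ₚ f g k))
  (solve 4 (λ f g a b → (f :* g) :* (a :* b) := (f :* a) :* (g :* b)) ≐-refl f g (f ^ₚ k) (g ^ₚ k))

^ₚ-* : ∀ f a b → (f ^ₚ a) ^ₚ b ≐ f ^ₚ (a ℕ.* b)
^ₚ-* f a zero    rewrite ℕₚ.*-zeroʳ a = ≐-refl
^ₚ-* f a (suc b) rewrite ℕₚ.*-suc a b =
  ≐-trans (*ₚ-congʳ (f ^ₚ a) (^ₚ-* f a b)) (≐-sym (^ₚ-+ f a (a ℕ.* b)))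

q*ₚ-suc : ∀ f n → (q *ₚ f) (suc n) ≡ f n
q*ₚ-suc f n =
  trans (sumTo-head n _) (trans (cong (λ t → + 0 * f (suc n) + t) (one-term n)) (ℤₚ.+-identityˡ _))
  where
  one-term : ∀ n → sumTo n (λ i → q (suc i) * f (n ∸ i)) ≡ f n
  one-term zero    = ℤₚ.*-identityˡ (f 0)
  one-term (suc n) = trans (sumTo-head n _) (trans
    (cong₂ _+_ (ℤₚ.*-identityˡ (f (suc n))) (sumTo-zero n _ (λ i _ → ℤₚ.*-zeroˡ (f (n ∸ i)))))
    (ℤₚ.+-identityʳ _))

mono≐q^ : ∀ a → mono a ≐ q ^ₚ a
mono≐q^ zero    zero    = refl
mono≐q^ zero    (suc n) = refl
mono≐q^ (suc a) zero    = refl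
mono≐q^ (suc a) (suc n) = trans (mono≐q^ a n) (sym (q*ₚ-suc (q ^ₚ a) n))

mono-odd : ∀ n → mono (2 ℕ.* suc n ∸ 1) ≐ q *ₚ (q ^ₚ 2) ^ₚ n
mono-odd n = ≐-trans (mono≐q^ (2 ℕ.* suc n ∸ 1))
  (≐-trans (cong≐ (q ^ₚ_) (ℕₚ.+-suc n (n ℕ.+ 0))) (*ₚ-congʳ q (≐-sym (^ₚ-* q 2 n))))

infix 4 q^_∣_
q^_∣_ : ℕ → PS → Set
q^ k ∣ f = ∀ n → n < k → f n ≡ + 0

q^∣-resp-≐ : ∀ {k f g} → f ≐ g → q^ k ∣ f → q^ k ∣ g
q^∣-resp-≐ f≐g k∣f n n<k = trans (sym (f≐g n)) (k∣f n n<k)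

q^∣-weaken : ∀ {k l f} → l ≤ k → q^ k ∣ f → q^ l ∣ f
q^∣-weaken l≤k k∣f n n<l = k∣f n (ℕₚ.<-≤-trans n<l l≤k)

q^∣-+ₚ : ∀ {k f g} → q^ k ∣ f → q^ k ∣ g → q^ k ∣ f +ₚ g
q^∣-+ₚ k∣f k∣g n n<k rewrite k∣f n n<k | k∣g n n<k = refl

q^∣-*ₚ : ∀ {a b f g} → q^ a ∣ f → q^ b ∣ g → q^ (a ℕ.+ b) ∣ f *ₚ g
q^∣-*ₚ {a} {b} {f} {g} a∣f b∣g n n<a+b = sumTo-zero n _ term
  where
  term : ∀ i → i ≤ n → f i * g (n ∸ i) ≡ + 0
  term i i≤n with i ℕ.<? a
  ... | yes i<a rewrite a∣f i i<a = refl
  ... | no i≮a  = trans (cong (f i *_) (b∣g (n ∸ i) n∸i<b)) (ℤₚ.*-zeroʳ (f i))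
    where
    a≤i = ℕₚ.≮⇒≥ i≮a
    n∸i<b : n ∸ i < b
    n∸i<b = ℕₚ.≤-<-trans (ℕₚ.∸-monoʳ-≤ n a≤i)
      (subst (n ∸ a <_) (ℕₚ.m+n∸m≡n a b) (ℕₚ.∸-monoˡ-< n<a+b (ℕₚ.≤-trans a≤i i≤n)))

q^∣-*ₚʳ : ∀ {a f} g → q^ a ∣ f → q^ a ∣ f *ₚ g
q^∣-*ₚʳ {a} {f} g a∣f =
  subst (λ t → q^ t ∣ f *ₚ g) (ℕₚ.+-identityʳ a) (q^∣-*ₚ {a} {0} {f} {g} a∣f (λ n ()))

q^∣-*ₚˡ : ∀ {a g} f → q^ a ∣ g → q^ a ∣ f *ₚ g
q^∣-*ₚˡ {g = g} f a∣g = q^∣-resp-≐ (*ₚ-comm g f) (q^∣-*ₚʳ f a∣g)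

q^∣-scale : ∀ {k} c f → q^ k ∣ f → q^ k ∣ scale c f
q^∣-scale c f k∣f n n<k rewrite k∣f n n<k = ℤₚ.*-zeroʳ c

q^∣-^ₚ : ∀ {f} k → q^ 1 ∣ f → q^ k ∣ f ^ₚ k
q^∣-^ₚ zero    1∣f n ()
q^∣-^ₚ (suc k) 1∣f = q^∣-*ₚ 1∣f (q^∣-^ₚ k 1∣f)

q^1∣q : q^ 1 ∣ q
q^1∣q zero    _         = refl
q^1∣q (suc n) (s≤s ())

q^1∣q² : q^ 1 ∣ q ^ₚ 2
q^1∣q² = q^∣-*ₚʳ (q ^ₚ 1) q^1∣q

Summable : (ℕ → PS) → Set
Summable F = ∀ k → q^ k ∣ F k

qsum-cong : ∀ {F G} → (∀ k → F k ≐ G k) → qsum F ≐ qsum G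
qsum-cong F≐G n = sumTo-cong n (λ k _ → F≐G k n)

qsum-+ : ∀ F G → qsum (λ k → F k +ₚ G k) ≐ qsum F +ₚ qsum G
qsum-+ F G n = sumTo-+ n (λ k → F k n) (λ k → G k n)

qsum-neg : ∀ F → qsum (λ k → negₚ (F k)) ≐ negₚ (qsum F)
qsum-neg F n = sumTo-neg n (λ k → F k n)

qsum-difference : ∀ F G → qsum (λ k → F k -ₚ G k) ≐ qsum F -ₚ qsum G
qsum-difference F G = ≐-trans (qsum-+ F (λ k → negₚ (G k))) (+ₚ-congʳ (qsum F) (qsum-neg G))

qsum-scale : ∀ a F → qsum (λ k → scale a (F k)) ≐ scale a (qsum F)
qsum-scale a F n = sumTo-*ˡ n a (λ k → F k n)

qsum-zero : ∀ F → (∀ k → F k ≐ 0ₚ) → qsum F ≐ 0ₚ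
qsum-zero F F≐0 n = sumTo-zero n _ (λ k _ → F≐0 k n)

qsum-truncate : ∀ F → Summable F → ∀ n N → n ≤ N → qsum F n ≡ sumTo N (λ k → F k n)
qsum-truncate F summable n N n≤N = sym (sumTo-extend n N _ n≤N (λ k n<k → summable k n n<k))

qsum-*ₚˡ : ∀ f F → Summable F → f *ₚ qsum F ≐ qsum (λ k → f *ₚ F k)
qsum-*ₚˡ f F summable n = begin
    sumTo n (λ i → f i * qsum F (n ∸ i))
  ≡⟨ sumTo-cong n (λ i _ → cong (f i *_) (qsum-truncate F summable (n ∸ i) n (ℕₚ.m∸n≤m n i))) ⟩
    sumTo n (λ i → f i * sumTo n (λ k → F k (n ∸ i)))
  ≡⟨ sumTo-cong n (λ i _ → sym (sumTo-*ˡ n (f i) _)) ⟩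
    sumTo n (λ i → sumTo n (λ k → f i * F k (n ∸ i)))
  ≡⟨ sumTo-swap n n _ ⟩
    sumTo n (λ k → sumTo n (λ i → f i * F k (n ∸ i)))
  ∎
  where open ≡-Reasoning

qsum-head : ∀ F → Summable F → qsum F ≐ F 0 +ₚ qsum (λ k → F (suc k))
qsum-head F summable n = trans (qsum-truncate F summable n (suc n) (ℕₚ.n≤1+n n)) (sumTo-head n _)

Summable-suc : ∀ F → Summable F → Summable (λ k → F (suc k))
Summable-suc F summable k = q^∣-weaken (ℕₚ.n≤1+n k) (summable (suc k))

qsum-head₂ : ∀ F → Summable F → qsum F ≐ F 0 +ₚ (F 1 +ₚ qsum (λ k → F (suc (suc k))))
qsum-head₂ F summable = ≐-trans (qsum-head F summable)
  (+ₚ-congʳ (F 0) (qsum-head (λ k → F (suc k)) (Summable-suc F summable)))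

qsum-shift : ∀ F → Summable F → F 0 ≐ 0ₚ → qsum F ≐ qsum (λ k → F (suc k))
qsum-shift F summable F₀≐0 = ≐-trans (qsum-head F summable)
  (≐-trans (+ₚ-congˡ _ F₀≐0) (λ n → ℤₚ.+-identityˡ _))

q^∣-qsum : ∀ K F → (∀ k → q^ K ∣ F k) → q^ K ∣ qsum F
q^∣-qsum K F K∣F n n<K = sumTo-zero n _ (λ k _ → K∣F k n n<K)


inv-cong : ∀ {f g} → f ≐ g → inv f ≐ inv g
inv-cong f≐g = qsum-cong (λ k → ^ₚ-cong k (-ₚ-cong (≐-refl {1ₚ}) f≐g))

-- A geometric series telescopes: f · Σₖ (1 - f)ᵏ = Σₖ (gᵏ - gᵏ⁺¹) with g = 1 - f.
*ₚ-inverseʳ : ∀ f → f 0 ≡ + 1 → f *ₚ inv f ≐ 1ₚ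
*ₚ-inverseʳ f f₀≡1 = begin
    f *ₚ qsum G
  ≈⟨ qsum-*ₚˡ f G summable ⟩
    qsum (λ k → f *ₚ G k)
  ≈⟨ qsum-cong (λ k → solve 2 (λ f h → f :* h := h :+ :- ((con (+ 1) :- f) :* h)) ≐-refl f (G k)) ⟩
    qsum (λ k → G k +ₚ negₚ (G (suc k)))
  ≈⟨ qsum-+ G (λ k → negₚ (G (suc k))) ⟩
    qsum G +ₚ qsum (λ k → negₚ (G (suc k)))
  ≈⟨ +ₚ-cong (qsum-head G summable) (qsum-neg (λ k → G (suc k))) ⟩
    (1ₚ +ₚ qsum (λ k → G (suc k))) +ₚ negₚ (qsum (λ k → G (suc k)))
  ≈⟨ solve 1 (λ a → (con (+ 1) :+ a) :+ (:- a) := con (+ 1)) ≐-refl (qsum (λ k → G (suc k))) ⟩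
    1ₚ
  ∎
  where
  open ≐-Reasoning
  G : ℕ → PS
  G k = (1ₚ -ₚ f) ^ₚ k
  1∣1-f : q^ 1 ∣ 1ₚ -ₚ f
  1∣1-f zero    _         = cong (λ t → + 1 - t) f₀≡1
  1∣1-f (suc n) (s≤s ())
  summable : Summable G
  summable k = q^∣-^ₚ k 1∣1-f

inv-1ₚ : inv 1ₚ ≐ 1ₚ
inv-1ₚ = ≐-trans (≐-sym (*ₚ-identityˡ (inv 1ₚ))) (*ₚ-inverseʳ 1ₚ refl)

*ₚ-cancelˡ : ∀ a b x y → a *ₚ b ≐ 1ₚ → a *ₚ x ≐ a *ₚ y → x ≐ y
*ₚ-cancelˡ a b x y ab≐1 ax≐ay = begin
  x                 ≈⟨ solve 3 (λ a b x → x := b :* (a :* x) :+ (con (+ 1) :- a :* b) :* x) ≐-refl a b x ⟩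
  b *ₚ (a *ₚ x) +ₚ (1ₚ -ₚ a *ₚ b) *ₚ x
                    ≈⟨ +ₚ-cong (*ₚ-congʳ b ax≐ay) (*ₚ-congˡ x 1-ab≐0) ⟩
  b *ₚ (a *ₚ y) +ₚ 0ₚ *ₚ x
                    ≈⟨ solve 4 (λ a b x y → b :* (a :* y) :+ con (+ 0) :* x
                                           := y :+ (a :* b :- con (+ 1)) :* y) ≐-refl a b x y ⟩
  y +ₚ (a *ₚ b -ₚ 1ₚ) *ₚ y
                    ≈⟨ +ₚ-congʳ y (*ₚ-congˡ y (-ₚ-cong ab≐1 (≐-refl {1ₚ}))) ⟩
  y +ₚ (1ₚ -ₚ 1ₚ) *ₚ y
                    ≈⟨ solve 1 (λ y → y :+ (con (+ 1) :- con (+ 1)) :* y := y) ≐-refl y ⟩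
  y                 ∎
  where
  open ≐-Reasoning
  1-ab≐0 : 1ₚ -ₚ a *ₚ b ≐ 0ₚ
  1-ab≐0 n = trans (cong (λ t → 1ₚ n - t) (ab≐1 n)) (ℤₚ.+-inverseʳ (1ₚ n))

-- Gaussian polynomials

module Gaussian (p : PS) (p₀ : q^ 1 ∣ p) where

  Q : ℕ → PS
  Q n = qPoch p p n

  Q⁻¹ : ℕ → PS
  Q⁻¹ n = inv (Q n)

  Q-constant : ∀ n → Q n 0 ≡ + 1
  Q-constant zero = refl
  Q-constant (suc n) rewrite Q-constant n | p₀ 0 (s≤s z≤n) = refl

  Q*Q⁻¹ : ∀ n → Q n *ₚ Q⁻¹ n ≐ 1ₚ
  Q*Q⁻¹ n = *ₚ-inverseʳ (Q n) (Q-constant n)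

  Q-cancel : ∀ i j X → (Q i *ₚ Q j) *ₚ (X *ₚ Q⁻¹ i *ₚ Q⁻¹ j) ≐ X
  Q-cancel i j X = begin
    (Q i *ₚ Q j) *ₚ (X *ₚ Q⁻¹ i *ₚ Q⁻¹ j)
      ≈⟨ solve 5 (λ a b c d x → (a :* b) :* (x :* c :* d) := (a :* c) :* (b :* d) :* x) ≐-refl
           (Q i) (Q j) (Q⁻¹ i) (Q⁻¹ j) X ⟩
    (Q i *ₚ Q⁻¹ i) *ₚ (Q j *ₚ Q⁻¹ j) *ₚ X
      ≈⟨ *ₚ-congˡ X (*ₚ-cong (Q*Q⁻¹ i) (Q*Q⁻¹ j)) ⟩
    1ₚ *ₚ 1ₚ *ₚ X
      ≈⟨ solve 1 (λ x → con (+ 1) :* con (+ 1) :* x := x) ≐-refl X ⟩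
    X ∎
    where open ≐-Reasoning

  gauss≐ : ∀ n k d → k ℕ.+ d ≡ n → gauss p n k ≐ Q n *ₚ Q⁻¹ k *ₚ Q⁻¹ d
  gauss≐ n k d k+d≡n with k ≤ᵇ n | ℕₚ.≤⇒≤ᵇ {k} {n} (subst (k ≤_) k+d≡n (ℕₚ.m≤m+n k d))
  ... | true  | _ rewrite sym k+d≡n | ℕₚ.m+n∸m≡n k d = ≐-refl
  ... | false | ()

  gauss-zero : ∀ n → gauss p n 0 ≐ 1ₚ
  gauss-zero n = begin
    gauss p n 0                   ≈⟨ gauss≐ n 0 n refl ⟩
    Q n *ₚ inv 1ₚ *ₚ Q⁻¹ n        ≈⟨ *ₚ-congˡ (Q⁻¹ n) (*ₚ-congʳ (Q n) inv-1ₚ) ⟩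
    Q n *ₚ 1ₚ *ₚ Q⁻¹ n            ≈⟨ *ₚ-congˡ (Q⁻¹ n) (*ₚ-identityʳ (Q n)) ⟩
    Q n *ₚ Q⁻¹ n                  ≈⟨ Q*Q⁻¹ n ⟩
    1ₚ                            ∎
    where open ≐-Reasoning

  gauss-diagonal : ∀ n → gauss p n n ≐ 1ₚ
  gauss-diagonal n = begin
    gauss p n n                   ≈⟨ gauss≐ n n 0 (ℕₚ.+-identityʳ n) ⟩
    Q n *ₚ Q⁻¹ n *ₚ inv 1ₚ        ≈⟨ *ₚ-congʳ (Q n *ₚ Q⁻¹ n) inv-1ₚ ⟩
    Q n *ₚ Q⁻¹ n *ₚ 1ₚ            ≈⟨ *ₚ-identityʳ _ ⟩
    Q n *ₚ Q⁻¹ n                  ≈⟨ Q*Q⁻¹ n ⟩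
    1ₚ                            ∎
    where open ≐-Reasoning

  -- The Pascal rule for Gaussian polynomials with its denominators cleared:
  -- (p;p)_{n+1} = (p;p)_n (1 - p^{r+1}) + p^{r+1} (p;p)_n (1 - p^{k+1}).
  Q-pascal : ∀ k r → let n = suc k ℕ.+ r in
    (Q (suc k) *ₚ Q (suc r)) *ₚ (Q n *ₚ Q⁻¹ (suc k) *ₚ Q⁻¹ r +ₚ p ^ₚ suc r *ₚ (Q n *ₚ Q⁻¹ k *ₚ Q⁻¹ (suc r)))
    ≐ Q (suc n)
  Q-pascal k r = begin
      ((Q k *ₚ (1ₚ -ₚ pᵏ)) *ₚ (Q r *ₚ (1ₚ -ₚ pʳ))) *ₚ (X₁ +ₚ pʳ *ₚ X₂)
    ≈⟨ solve 7 (λ Qk u Qr v pʳ X₁ X₂ → ((Qk :* u) :* (Qr :* v)) :* (X₁ :+ pʳ :* X₂)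
                  := v :* (((Qk :* u) :* Qr) :* X₁) :+ pʳ :* u :* ((Qk :* (Qr :* v)) :* X₂))
         ≐-refl (Q k) (1ₚ -ₚ pᵏ) (Q r) (1ₚ -ₚ pʳ) pʳ X₁ X₂ ⟩
      (1ₚ -ₚ pʳ) *ₚ ((Q (suc k) *ₚ Q r) *ₚ X₁) +ₚ pʳ *ₚ (1ₚ -ₚ pᵏ) *ₚ ((Q k *ₚ Q (suc r)) *ₚ X₂)
    ≈⟨ +ₚ-cong (*ₚ-congʳ (1ₚ -ₚ pʳ) (Q-cancel (suc k) r (Q n)))
               (*ₚ-congʳ (pʳ *ₚ (1ₚ -ₚ pᵏ)) (Q-cancel k (suc r) (Q n))) ⟩
      (1ₚ -ₚ pʳ) *ₚ Q n +ₚ pʳ *ₚ (1ₚ -ₚ pᵏ) *ₚ Q n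
    ≈⟨ solve 3 (λ Qn pʳ pᵏ → (con (+ 1) :- pʳ) :* Qn :+ pʳ :* (con (+ 1) :- pᵏ) :* Qn
                  := Qn :* (con (+ 1) :- pʳ :* pᵏ)) ≐-refl (Q n) pʳ pᵏ ⟩
      Q n *ₚ (1ₚ -ₚ pʳ *ₚ pᵏ)
    ≈⟨ *ₚ-congʳ (Q n) (-ₚ-cong (≐-refl {1ₚ}) pʳ*pᵏ) ⟩
      Q (suc n)
    ∎
    where
    open ≐-Reasoning
    n  = suc k ℕ.+ r
    pʳ = p ^ₚ suc r
    pᵏ = p ^ₚ suc k
    X₁ = Q n *ₚ Q⁻¹ (suc k) *ₚ Q⁻¹ r
    X₂ = Q n *ₚ Q⁻¹ k *ₚ Q⁻¹ (suc r)
    pʳ*pᵏ : pʳ *ₚ pᵏ ≐ p ^ₚ suc n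
    pʳ*pᵏ = ≐-trans (≐-sym (^ₚ-+ p (suc r) (suc k)))
      (cong≐ (p ^ₚ_) (cong suc (trans (ℕₚ.+-suc r k) (cong suc (ℕₚ.+-comm r k)))))

  gauss-pascal : ∀ k r → gauss p (suc (suc k ℕ.+ r)) (suc k)
                       ≐ gauss p (suc k ℕ.+ r) (suc k) +ₚ p ^ₚ suc r *ₚ gauss p (suc k ℕ.+ r) k
  gauss-pascal k r = begin
      gauss p (suc n) (suc k)
    ≈⟨ gauss≐ (suc n) (suc k) (suc r) (cong suc (ℕₚ.+-suc k r)) ⟩
      Q (suc n) *ₚ Q⁻¹ (suc k) *ₚ Q⁻¹ (suc r)
    ≈⟨ *ₚ-cancelˡ a (Q⁻¹ (suc k) *ₚ Q⁻¹ (suc r)) _ _ a*a⁻¹≐1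
         (≐-trans (Q-cancel (suc k) (suc r) (Q (suc n))) (≐-sym (Q-pascal k r))) ⟩
      Q n *ₚ Q⁻¹ (suc k) *ₚ Q⁻¹ r +ₚ p ^ₚ suc r *ₚ (Q n *ₚ Q⁻¹ k *ₚ Q⁻¹ (suc r))
    ≈⟨ ≐-sym (+ₚ-cong (gauss≐ n (suc k) r refl)
                      (*ₚ-congʳ (p ^ₚ suc r) (gauss≐ n k (suc r) (ℕₚ.+-suc k r)))) ⟩
      gauss p n (suc k) +ₚ p ^ₚ suc r *ₚ gauss p n k
    ∎
    where
    open ≐-Reasoning
    n = suc k ℕ.+ r
    a = Q (suc k) *ₚ Q (suc r)
    a*a⁻¹≐1 : a *ₚ (Q⁻¹ (suc k) *ₚ Q⁻¹ (suc r)) ≐ 1ₚ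
    a*a⁻¹≐1 = ≐-trans (solve 4 (λ a b c d → (a :* b) :* (c :* d) := (a :* b) :* (con (+ 1) :* c :* d))
                         ≐-refl (Q (suc k)) (Q (suc r)) (Q⁻¹ (suc k)) (Q⁻¹ (suc r)))
                      (Q-cancel (suc k) (suc r) 1ₚ)

-- The coefficients B

C-pascal : ∀ n k → suc n C suc k ≡ n C k ℕ.+ n C suc k
C-pascal n k = sym (nCk+nC[k+1]≡[n+1]C[k+1] n k)

C-absorption : ∀ n r → suc r ℕ.* (suc n C suc r) ≡ suc n ℕ.* (n C r)
C-absorption zero zero = refl
C-absorption zero (suc r)
  rewrite k>n⇒nCk≡0 {1} {suc (suc r)} (s≤s (s≤s z≤n)) | k>n⇒nCk≡0 {0} {suc r} (s≤s z≤n) =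
  ℕₚ.*-zeroʳ (suc (suc r))
C-absorption (suc n) zero rewrite nC1≡n (suc (suc n)) = trans (ℕₚ.+-identityʳ _) (sym (ℕₚ.*-identityʳ _))
C-absorption (suc n) (suc r) = begin
    suc (suc r) ℕ.* (suc (suc n) C suc (suc r))
  ≡⟨ cong (suc (suc r) ℕ.*_) (C-pascal (suc n) (suc r)) ⟩
    suc (suc r) ℕ.* (suc n C suc r ℕ.+ suc n C suc (suc r))
  ≡⟨ ℕₚ.*-distribˡ-+ (suc (suc r)) (suc n C suc r) (suc n C suc (suc r)) ⟩
    suc n C suc r ℕ.+ suc r ℕ.* (suc n C suc r) ℕ.+ suc (suc r) ℕ.* (suc n C suc (suc r))
  ≡⟨ cong₂ ℕ._+_ (cong (suc n C suc r ℕ.+_) (C-absorption n r)) (C-absorption n (suc r)) ⟩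
    suc n C suc r ℕ.+ suc n ℕ.* (n C r) ℕ.+ suc n ℕ.* (n C suc r)
  ≡⟨ regroup (suc n C suc r) (suc n) (n C r) (n C suc r) ⟩
    suc n C suc r ℕ.+ suc n ℕ.* (n C r ℕ.+ n C suc r)
  ≡⟨ cong (λ t → suc n C suc r ℕ.+ suc n ℕ.* t) (sym (C-pascal n r)) ⟩
    suc (suc n) ℕ.* (suc n C suc r)
  ∎
  where
  open ≡-Reasoning
  regroup : ∀ a b c d → a ℕ.+ b ℕ.* c ℕ.+ b ℕ.* d ≡ a ℕ.+ b ℕ.* (c ℕ.+ d)
  regroup = ℕ-Solver.solve-∀

C-absorption-pascal : ∀ N r → suc N ℕ.* (N C r) ℕ.+ r ℕ.* (suc N C r) ≡ suc N ℕ.* (suc N C r)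
C-absorption-pascal N zero    = ℕₚ.+-identityʳ _
C-absorption-pascal N (suc r) = begin
    suc N ℕ.* (N C suc r) ℕ.+ suc r ℕ.* (suc N C suc r)
  ≡⟨ cong (suc N ℕ.* (N C suc r) ℕ.+_) (C-absorption N r) ⟩
    suc N ℕ.* (N C suc r) ℕ.+ suc N ℕ.* (N C r)
  ≡⟨ sym (ℕₚ.*-distribˡ-+ (suc N) (N C suc r) (N C r)) ⟩
    suc N ℕ.* (N C suc r ℕ.+ N C r)
  ≡⟨ cong (suc N ℕ.*_) (trans (ℕₚ.+-comm (N C suc r) (N C r)) (sym (C-pascal N r))) ⟩
    suc N ℕ.* (suc N C suc r)
  ∎
  where open ≡-Reasoning

C-second-difference : ∀ N r → suc (suc N) C suc (suc r) ℕ.+ N C suc (suc r)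
                             ≡ 2 ℕ.* (suc N C suc (suc r)) ℕ.+ N C r
C-second-difference N r
  rewrite C-pascal (suc N) (suc r) | C-pascal N r | C-pascal N (suc r) =
  rearrange (N C r) (N C suc r) (N C suc (suc r))
  where
  rearrange : ∀ a b c → a ℕ.+ b ℕ.+ (b ℕ.+ c) ℕ.+ c ≡ 2 ℕ.* (b ℕ.+ c) ℕ.+ a
  rearrange = ℕ-Solver.solve-∀

C₂ : ℕ → ℕ → ℕ
C₂ s r = suc s C r ℕ.+ s C r

C₂-second-difference : ∀ s r → C₂ (2 ℕ.+ s) (2 ℕ.+ r) ℕ.+ C₂ s (2 ℕ.+ r)
                              ≡ 2 ℕ.* C₂ (1 ℕ.+ s) (2 ℕ.+ r) ℕ.+ C₂ s r
C₂-second-difference s r = begin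
    (a₃ ℕ.+ a₂) ℕ.+ (a₁ ℕ.+ a₀)
  ≡⟨ interchange a₃ a₂ a₁ a₀ ⟩
    (a₃ ℕ.+ a₁) ℕ.+ (a₂ ℕ.+ a₀)
  ≡⟨ cong₂ ℕ._+_ (C-second-difference (suc s) r) (C-second-difference s r) ⟩
    (2 ℕ.* a₂ ℕ.+ suc s C r) ℕ.+ (2 ℕ.* a₁ ℕ.+ s C r)
  ≡⟨ collect a₂ a₁ (suc s C r) (s C r) ⟩
    2 ℕ.* (a₂ ℕ.+ a₁) ℕ.+ (suc s C r ℕ.+ s C r)
  ∎
  where
  open ≡-Reasoning
  a₃ = suc (suc (suc s)) C suc (suc r)
  a₂ = suc (suc s) C suc (suc r)
  a₁ = suc s C suc (suc r)
  a₀ = s C suc (suc r)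
  interchange : ∀ a b c d → (a ℕ.+ b) ℕ.+ (c ℕ.+ d) ≡ (a ℕ.+ c) ℕ.+ (b ℕ.+ d)
  interchange = ℕ-Solver.solve-∀
  collect : ∀ a b c d → (2 ℕ.* a ℕ.+ c) ℕ.+ (2 ℕ.* b ℕ.+ d) ≡ 2 ℕ.* (a ℕ.+ b) ℕ.+ (c ℕ.+ d)
  collect = ℕ-Solver.solve-∀

C₂-*-suc : ∀ k J → C₂ (k ℕ.+ J) (2 ℕ.* suc J) ℕ.* suc (k ℕ.+ J) ≡ 2 ℕ.* k ℕ.* (suc (k ℕ.+ J) C (2 ℕ.* suc J))
C₂-*-suc k J = ℕₚ.+-cancelʳ-≡ (r ℕ.* X) _ _ (begin
    (X ℕ.+ Y) ℕ.* s ℕ.+ r ℕ.* X    ≡⟨ expand X Y s (r ℕ.* X) ⟩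
    X ℕ.* s ℕ.+ (s ℕ.* Y ℕ.+ r ℕ.* X) ≡⟨ cong (X ℕ.* s ℕ.+_) (C-absorption-pascal (k ℕ.+ J) r) ⟩
    X ℕ.* s ℕ.+ s ℕ.* X            ≡⟨ double k J X ⟩
    2 ℕ.* k ℕ.* X ℕ.+ r ℕ.* X      ∎)
  where
  open ≡-Reasoning
  s = suc (k ℕ.+ J)
  r = 2 ℕ.* suc J
  X = s C r
  Y = (k ℕ.+ J) C r
  expand : ∀ x y s t → (x ℕ.+ y) ℕ.* s ℕ.+ t ≡ x ℕ.* s ℕ.+ (s ℕ.* y ℕ.+ t)
  expand = ℕ-Solver.solve-∀
  double : ∀ k J x → x ℕ.* suc (k ℕ.+ J) ℕ.+ suc (k ℕ.+ J) ℕ.* x ≡ 2 ℕ.* k ℕ.* x ℕ.+ 2 ℕ.* suc J ℕ.* x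
  double = ℕ-Solver.solve-∀

B-C₂ : ∀ k J → B k (suc J) ≡ C₂ (k ℕ.+ J) (2 ℕ.* suc J)
B-C₂ k J = begin
    B k (suc J)
  ≡⟨ unfold-B k ⟩
    2 ℕ.* k ℕ.* ((k ℕ.+ suc J) C (2 ℕ.* suc J)) ℕ./ suc (k ℕ.+ J)
  ≡⟨ ℕ./-congˡ (cong (λ t → 2 ℕ.* k ℕ.* (t C (2 ℕ.* suc J))) (ℕₚ.+-suc k J)) ⟩
    2 ℕ.* k ℕ.* (suc (k ℕ.+ J) C (2 ℕ.* suc J)) ℕ./ suc (k ℕ.+ J)
  ≡⟨ ℕ./-congˡ (sym (C₂-*-suc k J)) ⟩
    C₂ (k ℕ.+ J) (2 ℕ.* suc J) ℕ.* suc (k ℕ.+ J) ℕ./ suc (k ℕ.+ J)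
  ≡⟨ ℕ.m*n/n≡m (C₂ (k ℕ.+ J) (2 ℕ.* suc J)) (suc (k ℕ.+ J)) ⟩
    C₂ (k ℕ.+ J) (2 ℕ.* suc J)
  ∎
  where
  open ≡-Reasoning
  unfold-B : ∀ k → B k (suc J) ≡ 2 ℕ.* k ℕ.* ((k ℕ.+ suc J) C (2 ℕ.* suc J)) ℕ./ suc (k ℕ.+ J)
  unfold-B zero    = refl
  unfold-B (suc k) = refl

B-suc-C₂ : ∀ n J → B (suc n) J ≡ C₂ (n ℕ.+ J) (2 ℕ.* J)
B-suc-C₂ n zero    = refl
B-suc-C₂ n (suc J) = trans (B-C₂ (suc n) J) (cong (λ t → C₂ t (2 ℕ.* suc J)) (sym (ℕₚ.+-suc n J)))

B-vanishes : ∀ {k j} → k < j → B k j ≡ 0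
B-vanishes {k} {suc J} (s≤s k≤J) =
  trans (B-C₂ k J) (cong₂ ℕ._+_ (k>n⇒nCk≡0 top<) (k>n⇒nCk≡0 (ℕₚ.<-trans (ℕₚ.n<1+n _) top<)))
  where
  top< : suc (k ℕ.+ J) < 2 ℕ.* suc J
  top< = ℕₚ.≤-trans (s≤s (s≤s (ℕₚ.+-monoˡ-≤ J k≤J))) (ℕₚ.≤-reflexive (twice J))
    where
    twice : ∀ J → suc (suc (J ℕ.+ J)) ≡ 2 ℕ.* suc J
    twice = ℕ-Solver.solve-∀

2*suc : ∀ J → 2 ℕ.* suc J ≡ 2 ℕ.+ 2 ℕ.* J
2*suc = ℕ-Solver.solve-∀

B-second-difference : ∀ n J → B (2 ℕ.+ n) (suc J) ℕ.+ B n (suc J) ≡ 2 ℕ.* B (1 ℕ.+ n) (suc J) ℕ.+ B (1 ℕ.+ n) J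
B-second-difference n J = begin
    B (2 ℕ.+ n) (suc J) ℕ.+ B n (suc J)
  ≡⟨ cong₂ ℕ._+_ (B-C₂ (2 ℕ.+ n) J) (B-C₂ n J) ⟩
    C₂ (2 ℕ.+ s) (2 ℕ.* suc J) ℕ.+ C₂ s (2 ℕ.* suc J)
  ≡⟨ cong (λ r → C₂ (2 ℕ.+ s) r ℕ.+ C₂ s r) (2*suc J) ⟩
    C₂ (2 ℕ.+ s) (2 ℕ.+ 2 ℕ.* J) ℕ.+ C₂ s (2 ℕ.+ 2 ℕ.* J)
  ≡⟨ C₂-second-difference s (2 ℕ.* J) ⟩
    2 ℕ.* C₂ (1 ℕ.+ s) (2 ℕ.+ 2 ℕ.* J) ℕ.+ C₂ s (2 ℕ.* J)
  ≡⟨ cong₂ (λ r b → 2 ℕ.* C₂ (1 ℕ.+ s) r ℕ.+ b) (sym (2*suc J)) (sym (B-suc-C₂ n J)) ⟩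
    2 ℕ.* C₂ (1 ℕ.+ s) (2 ℕ.* suc J) ℕ.+ B (1 ℕ.+ n) J
  ≡⟨ cong (λ b → 2 ℕ.* b ℕ.+ B (1 ℕ.+ n) J) (sym (B-C₂ (1 ℕ.+ n) J)) ⟩
    2 ℕ.* B (1 ℕ.+ n) (suc J) ℕ.+ B (1 ℕ.+ n) J
  ∎
  where
  open ≡-Reasoning
  s = n ℕ.+ J

Bprev : ℕ → ℕ → ℕ
Bprev k zero    = 0
Bprev k (suc j) = B k j

natₚ : ℕ → PS
natₚ n = constₚ (+ n)

natₚ-zero : natₚ 0 ≐ 0ₚ
natₚ-zero zero    = refl
natₚ-zero (suc n) = refl

natₚ-+ : ∀ a b → natₚ (a ℕ.+ b) ≐ natₚ a +ₚ natₚ b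
natₚ-+ a b = ≐-trans (cong≐ constₚ (ℤₚ.pos-+ a b)) (constₚ-+ (+ a) (+ b))

natₚ-* : ∀ a b → natₚ (a ℕ.* b) ≐ natₚ a *ₚ natₚ b
natₚ-* a b = ≐-trans (cong≐ constₚ (ℤₚ.pos-* a b)) (constₚ-* (+ a) (+ b))

weightedSum : (ℕ → ℕ) → (ℕ → PS) → PS
weightedSum w c = qsum (λ k → natₚ (w k) *ₚ c k)

Summable-weighted : ∀ (w : ℕ → ℕ) c → Summable c → Summable (λ k → natₚ (w k) *ₚ c k)
Summable-weighted w c summable k = q^∣-*ₚˡ (natₚ (w k)) (summable k)

-- c_{k+1} + c_{k-1}, with the reflection c_{-1} := c_1.
neighbourSum : (ℕ → PS) → ℕ → PS
neighbourSum c zero    = c 1 +ₚ c 1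
neighbourSum c (suc k) = c (suc (suc k)) +ₚ c k

-- The transpose of neighbourSum: Σₖ wₖ (neighbourSum c)ₖ = Σₖ (neighbourSumᵀ w)ₖ cₖ.
neighbourSumᵀ : (ℕ → ℕ) → ℕ → ℕ
neighbourSumᵀ w zero          = w 1
neighbourSumᵀ w (suc zero)    = w 0 ℕ.+ w 0 ℕ.+ w 2
neighbourSumᵀ w (suc (suc k)) = w (suc k) ℕ.+ w (suc (suc (suc k)))

B-neighbourSumᵀ : ∀ j k → neighbourSumᵀ (λ k → B k j) k ≡ 2 ℕ.* B k j ℕ.+ Bprev k j
B-neighbourSumᵀ zero          zero          = refl
B-neighbourSumᵀ zero          (suc zero)    = refl
B-neighbourSumᵀ zero          (suc (suc k)) = refl
B-neighbourSumᵀ (suc zero)    zero          = refl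
B-neighbourSumᵀ (suc (suc J)) zero
  rewrite B-vanishes {1} {suc (suc J)} (s≤s (s≤s z≤n)) | B-vanishes {0} {suc (suc J)} (s≤s z≤n)
        | B-vanishes {0} {suc J} (s≤s z≤n) = refl
B-neighbourSumᵀ (suc J)       (suc zero)    = begin
    B 0 (suc J) ℕ.+ B 0 (suc J) ℕ.+ B 2 (suc J)  ≡⟨ cong (λ b → b ℕ.+ b ℕ.+ B 2 (suc J)) B₀≡0 ⟩
    B 2 (suc J)                                  ≡⟨ sym (ℕₚ.+-identityʳ _) ⟩
    B 2 (suc J) ℕ.+ 0                            ≡⟨ cong (B 2 (suc J) ℕ.+_) (sym B₀≡0) ⟩
    B 2 (suc J) ℕ.+ B 0 (suc J)                  ≡⟨ B-second-difference 0 J ⟩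
    2 ℕ.* B 1 (suc J) ℕ.+ B 1 J                  ∎
  where
  open ≡-Reasoning
  B₀≡0 = B-vanishes {0} {suc J} (s≤s z≤n)
B-neighbourSumᵀ (suc J)       (suc (suc k)) =
  trans (ℕₚ.+-comm (B (suc k) (suc J)) _) (B-second-difference (suc k) J)

-- Both sides equal 2u₀ + Σₖ u_{k+1} + Σₖ vₖ, where uₖ = wₖ X c_{k+1} and
-- vₖ = w_{k+1} X cₖ collect the forward and the backward neighbours.
module _ (w : ℕ → ℕ) (c : ℕ → PS) (X : PS) (summable : Summable c) (X₀ : q^ 1 ∣ X) where

  private
    u v : ℕ → PS
    u k = natₚ (w k) *ₚ (X *ₚ c (suc k))
    v k = natₚ (w (suc k)) *ₚ (X *ₚ c k)

    summable-v : Summable v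
    summable-v k = q^∣-*ₚˡ (natₚ (w (suc k))) (q^∣-*ₚˡ X (summable k))

    by-neighbours : qsum (λ k → natₚ (w k) *ₚ (X *ₚ neighbourSum c k))
                  ≐ (u 0 +ₚ u 0) +ₚ (qsum (λ k → u (suc k)) +ₚ qsum v)
    by-neighbours = begin
        qsum T
      ≈⟨ qsum-head T summable-T ⟩
        T 0 +ₚ qsum (λ k → T (suc k))
      ≈⟨ +ₚ-cong (solve 3 (λ w X c → w :* (X :* (c :+ c)) := w :* (X :* c) :+ w :* (X :* c)) ≐-refl
                      (natₚ (w 0)) X (c 1))
                 (qsum-cong (λ k → solve 4 (λ w X a b → w :* (X :* (a :+ b)) := w :* (X :* a) :+ w :* (X :* b))
                      ≐-refl (natₚ (w (suc k))) X (c (suc (suc k))) (c k))) ⟩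
        (u 0 +ₚ u 0) +ₚ qsum (λ k → u (suc k) +ₚ v k)
      ≈⟨ +ₚ-congʳ (u 0 +ₚ u 0) (qsum-+ (λ k → u (suc k)) v) ⟩
        (u 0 +ₚ u 0) +ₚ (qsum (λ k → u (suc k)) +ₚ qsum v)
      ∎
      where
      open ≐-Reasoning
      T : ℕ → PS
      T k = natₚ (w k) *ₚ (X *ₚ neighbourSum c k)
      summable-T : Summable T
      summable-T zero    = λ n ()
      summable-T (suc k) = q^∣-*ₚˡ (natₚ (w (suc k)))
        (q^∣-*ₚ X₀ (q^∣-+ₚ (q^∣-weaken (ℕₚ.≤-trans (ℕₚ.n≤1+n k) (ℕₚ.n≤1+n (suc k))) (summable (suc (suc k))))
                           (summable k)))

    by-weights : X *ₚ weightedSum (neighbourSumᵀ w) c ≐ (u 0 +ₚ u 0) +ₚ (qsum (λ k → u (suc k)) +ₚ qsum v)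
    by-weights = begin
        X *ₚ weightedSum (neighbourSumᵀ w) c
      ≈⟨ qsum-*ₚˡ X _ (Summable-weighted (neighbourSumᵀ w) c summable) ⟩
        qsum S
      ≈⟨ qsum-head₂ S (λ k → q^∣-*ₚˡ X (Summable-weighted (neighbourSumᵀ w) c summable k)) ⟩
        S 0 +ₚ (S 1 +ₚ qsum (λ k → S (suc (suc k))))
      ≈⟨ +ₚ-cong S₀ (+ₚ-cong S₁ (≐-trans (qsum-cong S₂₊) (qsum-+ (λ k → u (suc k)) (λ k → v (suc (suc k)))))) ⟩
        v 0 +ₚ ((u 0 +ₚ u 0 +ₚ v 1) +ₚ (qsum (λ k → u (suc k)) +ₚ qsum (λ k → v (suc (suc k)))))
      ≈⟨ solve 5 (λ u₀ v₀ v₁ U V → v₀ :+ ((u₀ :+ u₀ :+ v₁) :+ (U :+ V))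
                                   := (u₀ :+ u₀) :+ (U :+ (v₀ :+ (v₁ :+ V))))
           ≐-refl (u 0) (v 0) (v 1) (qsum (λ k → u (suc k))) (qsum (λ k → v (suc (suc k)))) ⟩
        (u 0 +ₚ u 0) +ₚ (qsum (λ k → u (suc k)) +ₚ (v 0 +ₚ (v 1 +ₚ qsum (λ k → v (suc (suc k))))))
      ≈⟨ +ₚ-congʳ (u 0 +ₚ u 0) (+ₚ-congʳ (qsum (λ k → u (suc k))) (≐-sym (qsum-head₂ v summable-v))) ⟩
        (u 0 +ₚ u 0) +ₚ (qsum (λ k → u (suc k)) +ₚ qsum v)
      ∎
      where
      open ≐-Reasoning
      S : ℕ → PS
      S k = X *ₚ (natₚ (neighbourSumᵀ w k) *ₚ c k)
      S₀ : S 0 ≐ v 0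
      S₀ = solve 3 (λ X w c → X :* (w :* c) := w :* (X :* c)) ≐-refl X (natₚ (w 1)) (c 0)
      S₁ : S 1 ≐ u 0 +ₚ u 0 +ₚ v 1
      S₁ = ≐-trans (*ₚ-congʳ X (*ₚ-congˡ (c 1) (≐-trans (natₚ-+ (w 0 ℕ.+ w 0) (w 2))
                                               (+ₚ-congˡ (natₚ (w 2)) (natₚ-+ (w 0) (w 0))))))
             (solve 4 (λ X w₀ w₂ c → X :* ((w₀ :+ w₀ :+ w₂) :* c)
                                    := w₀ :* (X :* c) :+ w₀ :* (X :* c) :+ w₂ :* (X :* c))
                ≐-refl X (natₚ (w 0)) (natₚ (w 2)) (c 1))
      S₂₊ : ∀ k → S (suc (suc k)) ≐ u (suc k) +ₚ v (suc (suc k))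
      S₂₊ k = ≐-trans (*ₚ-congʳ X (*ₚ-congˡ (c (suc (suc k))) (natₚ-+ (w (suc k)) (w (suc (suc (suc k)))))))
             (solve 4 (λ X a b c → X :* ((a :+ b) :* c) := a :* (X :* c) :+ b :* (X :* c))
                ≐-refl X (natₚ (w (suc k))) (natₚ (w (suc (suc (suc k))))) (c (suc (suc k))))

  weightedSum-neighbourSum : qsum (λ k → natₚ (w k) *ₚ (X *ₚ neighbourSum c k))
                           ≐ X *ₚ weightedSum (neighbourSumᵀ w) c
  weightedSum-neighbourSum = ≐-trans by-neighbours (≐-sym by-weights)

weightedSum-linear : ∀ (w w₁ w₂ : ℕ → ℕ) c → Summable c → (∀ k → w k ≡ 2 ℕ.* w₁ k ℕ.+ w₂ k) →
  weightedSum w c ≐ constₚ (+ 2) *ₚ weightedSum w₁ c +ₚ weightedSum w₂ c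
weightedSum-linear w w₁ w₂ c summable w≡ = begin
    qsum (λ k → natₚ (w k) *ₚ c k)
  ≈⟨ qsum-cong (λ k → ≐-trans (*ₚ-congˡ (c k) (split k))
       (solve 4 (λ two a b c → (two :* a :+ b) :* c := two :* (a :* c) :+ b :* c)
          ≐-refl (constₚ (+ 2)) (natₚ (w₁ k)) (natₚ (w₂ k)) (c k))) ⟩
    qsum (λ k → constₚ (+ 2) *ₚ (natₚ (w₁ k) *ₚ c k) +ₚ natₚ (w₂ k) *ₚ c k)
  ≈⟨ qsum-+ _ _ ⟩
    qsum (λ k → constₚ (+ 2) *ₚ (natₚ (w₁ k) *ₚ c k)) +ₚ weightedSum w₂ c
  ≈⟨ +ₚ-congˡ _ (≐-sym (qsum-*ₚˡ (constₚ (+ 2)) _ (Summable-weighted w₁ c summable))) ⟩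
    constₚ (+ 2) *ₚ weightedSum w₁ c +ₚ weightedSum w₂ c
  ∎
  where
  open ≐-Reasoning
  split : ∀ k → natₚ (w k) ≐ constₚ (+ 2) *ₚ natₚ (w₁ k) +ₚ natₚ (w₂ k)
  split k = ≐-trans (cong≐ natₚ (w≡ k))
    (≐-trans (natₚ-+ (2 ℕ.* w₁ k) (w₂ k)) (+ₚ-congˡ _ (natₚ-* 2 (w₁ k))))

-- Chain sums

chainSum : (ℕ → PS) → ℕ → ℕ → PS
chainSum t zero    m = 1ₚ
chainSum t (suc k) m = sum1 m (λ n → t n *ₚ chainSum t k n)

δ : ℕ → PS
δ zero    = 1ₚ
δ (suc _) = 0ₚ

chainSum-zero : ∀ t j → chainSum t j 0 ≐ δ j
chainSum-zero t zero    = ≐-refl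
chainSum-zero t (suc j) = ≐-refl

sum1-cong : ∀ m {f g : ℕ → PS} → (∀ n → f (suc n) ≐ g (suc n)) → sum1 m f ≐ sum1 m g
sum1-cong zero    f≐g = ≐-refl
sum1-cong (suc m) f≐g = +ₚ-cong (sum1-cong m f≐g) (f≐g m)

sum1-*ₚˡ : ∀ m a (f : ℕ → PS) → sum1 m (λ n → a *ₚ f n) ≐ a *ₚ sum1 m f
sum1-*ₚˡ zero    a f = solve 1 (λ a → con (+ 0) := a :* con (+ 0)) ≐-refl a
sum1-*ₚˡ (suc m) a f = ≐-trans (+ₚ-congˡ (a *ₚ f (suc m)) (sum1-*ₚˡ m a f))
  (≐-sym (*ₚ-distribˡ a (sum1 m f) (f (suc m))))

chainSum-scale : ∀ a {t t′ : ℕ → PS} → (∀ n → t (suc n) ≐ constₚ a *ₚ t′ (suc n)) →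
  ∀ j m → chainSum t j m ≐ constₚ (a ^ j) *ₚ chainSum t′ j m
chainSum-scale a t≐ zero    m = ≐-sym (≐-trans (*ₚ-congˡ 1ₚ constₚ-1) (*ₚ-identityˡ 1ₚ))
chainSum-scale a {t} {t′} t≐ (suc j) m =
  ≐-trans (sum1-cong m summand) (sum1-*ₚˡ m (constₚ (a ^ suc j)) (λ n → t′ n *ₚ chainSum t′ j n))
  where
  summand : ∀ n → t (suc n) *ₚ chainSum t j (suc n) ≐ constₚ (a ^ suc j) *ₚ (t′ (suc n) *ₚ chainSum t′ j (suc n))
  summand n = ≐-trans (*ₚ-cong (t≐ n) (chainSum-scale a t≐ j (suc n)))
    (≐-trans (solve 4 (λ α β u v → (α :* u) :* (β :* v) := (α :* β) :* (u :* v)) ≐-refl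
                (constₚ a) (constₚ (a ^ j)) (t′ (suc n)) (chainSum t′ j (suc n)))
             (*ₚ-congˡ (t′ (suc n) *ₚ chainSum t′ j (suc n)) (≐-sym (constₚ-* a (a ^ j)))))

V≐chainSum : ∀ ε j m → V ε j m ≐ chainSum (Vterm ε) j m
V≐chainSum ε zero    m = ≐-refl
V≐chainSum ε (suc j) m = sum1-cong m (λ n → *ₚ-congʳ (Vterm ε (suc n)) (V≐chainSum ε j (suc n)))

W≐chainSum : ∀ ε j m → W ε j m ≐ chainSum (Wterm ε) j m
W≐chainSum ε zero    m = ≐-refl
W≐chainSum ε (suc j) m = sum1-cong m (λ n → *ₚ-congʳ (Wterm ε (suc n)) (W≐chainSum ε j (suc n)))

-- The identity for indeterminates p and y

module Core (p y : PS) (p₀ : q^ 1 ∣ p) (y₀ : q^ 1 ∣ y) where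

  open Gaussian p p₀

  -- For m = 0, [m-1+a, a]_p is read as δ_{a,0}.
  g : ℕ → ℕ → PS
  g zero    a = δ a
  g (suc m) a = gauss p (m ℕ.+ a) a

  d : ℕ → ℕ → PS
  d m a = g m a *ₚ y ^ₚ a

  d₋₁ : ℕ → ℕ → PS
  d₋₁ m zero    = 0ₚ
  d₋₁ m (suc a) = d m a

  x : ℕ → PS
  x m = y *ₚ p ^ₚ m

  d-step : ∀ m a → d m a ≐ d (suc m) a -ₚ x m *ₚ d₋₁ (suc m) a
  d-step zero zero = begin
      1ₚ *ₚ 1ₚ
    ≈⟨ solve 1 (λ X → con (+ 1) :* con (+ 1) := con (+ 1) :* con (+ 1) :- X :* con (+ 0)) ≐-refl (x 0) ⟩
      1ₚ *ₚ 1ₚ -ₚ x 0 *ₚ 0ₚ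
    ≈⟨ -ₚ-cong (*ₚ-congˡ 1ₚ (≐-sym (gauss-diagonal 0))) ≐-refl ⟩
      gauss p 0 0 *ₚ 1ₚ -ₚ x 0 *ₚ 0ₚ
    ∎
    where open ≐-Reasoning
  d-step zero (suc a) = begin
      0ₚ *ₚ (y *ₚ Y)
    ≈⟨ solve 2 (λ y Y → con (+ 0) :* (y :* Y) := con (+ 1) :* (y :* Y) :- (y :* con (+ 1)) :* (con (+ 1) :* Y))
         ≐-refl y Y ⟩
      1ₚ *ₚ (y *ₚ Y) -ₚ (y *ₚ 1ₚ) *ₚ (1ₚ *ₚ Y)
    ≈⟨ -ₚ-cong (*ₚ-congˡ (y *ₚ Y) (≐-sym (gauss-diagonal (suc a))))
               (*ₚ-congʳ (y *ₚ 1ₚ) (*ₚ-congˡ Y (≐-sym (gauss-diagonal a)))) ⟩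
      gauss p (suc a) (suc a) *ₚ (y *ₚ Y) -ₚ (y *ₚ 1ₚ) *ₚ (gauss p a a *ₚ Y)
    ∎
    where
    open ≐-Reasoning
    Y = y ^ₚ a
  d-step (suc m) zero = begin
      gauss p (m ℕ.+ 0) 0 *ₚ 1ₚ
    ≈⟨ *ₚ-congˡ 1ₚ (≐-trans (gauss-zero (m ℕ.+ 0)) (≐-sym (gauss-zero (suc m ℕ.+ 0)))) ⟩
      gauss p (suc m ℕ.+ 0) 0 *ₚ 1ₚ
    ≈⟨ solve 2 (λ G X → G :* con (+ 1) := G :* con (+ 1) :- X :* con (+ 0)) ≐-refl
         (gauss p (suc m ℕ.+ 0) 0) (x (suc m)) ⟩
      gauss p (suc m ℕ.+ 0) 0 *ₚ 1ₚ -ₚ x (suc m) *ₚ 0ₚ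
    ∎
    where open ≐-Reasoning
  d-step (suc m) (suc a) = begin
      gauss p (m ℕ.+ suc a) (suc a) *ₚ (y *ₚ Y)
    ≈⟨ *ₚ-congˡ (y *ₚ Y) (cong≐ (λ n → gauss p n (suc a)) (ℕₚ.+-comm m (suc a))) ⟩
      G₁ *ₚ (y *ₚ Y)
    ≈⟨ solve 5 (λ G₁ G₀ P y Y → G₁ :* (y :* Y) := (G₁ :+ P :* G₀) :* (y :* Y) :- (y :* P) :* (G₀ :* Y))
         ≐-refl G₁ G₀ P y Y ⟩
      (G₁ +ₚ P *ₚ G₀) *ₚ (y *ₚ Y) -ₚ (y *ₚ P) *ₚ (G₀ *ₚ Y)
    ≈⟨ -ₚ-cong (*ₚ-congˡ (y *ₚ Y) (≐-trans (≐-sym (gauss-pascal a m))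
                                           (cong≐ (λ n → gauss p n (suc a)) (cong suc (ℕₚ.+-comm (suc a) m)))))
               (*ₚ-congʳ (y *ₚ P) (*ₚ-congˡ Y (cong≐ (λ n → gauss p n a) (cong suc (ℕₚ.+-comm a m))))) ⟩
      gauss p (suc m ℕ.+ suc a) (suc a) *ₚ (y *ₚ Y) -ₚ (y *ₚ P) *ₚ (gauss p (suc m ℕ.+ a) a *ₚ Y)
    ∎
    where
    open ≐-Reasoning
    Y  = y ^ₚ a
    P  = p ^ₚ suc m
    G₁ = gauss p (suc a ℕ.+ m) (suc a)
    G₀ = gauss p (suc a ℕ.+ m) a

  q^∣-d : ∀ m a → q^ a ∣ d m a
  q^∣-d m a = q^∣-*ₚˡ (g m a) (q^∣-^ₚ a y₀)

  q^∣-x : ∀ m → q^ 1 ∣ x m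
  q^∣-x m = q^∣-*ₚʳ (p ^ₚ m) y₀

  q^∣-x*d₋₁ : ∀ m m′ a → q^ a ∣ x m *ₚ d₋₁ m′ a
  q^∣-x*d₋₁ m m′ zero    = λ n ()
  q^∣-x*d₋₁ m m′ (suc a) = q^∣-*ₚ (q^∣-x m) (q^∣-d m′ a)

  c : ℕ → ℕ → PS
  c m k = qsum (λ i → d m i *ₚ d m (k ℕ.+ i))

  Summable-c-terms : ∀ m k → Summable (λ i → d m i *ₚ d m (k ℕ.+ i))
  Summable-c-terms m k i = q^∣-*ₚʳ (d m (k ℕ.+ i)) (q^∣-d m i)

  Summable-c : ∀ m → Summable (c m)
  Summable-c m k = q^∣-qsum k _ (λ i → q^∣-weaken (ℕₚ.m≤m+n k i) (q^∣-*ₚˡ (d m i) (q^∣-d m (k ℕ.+ i))))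

  -- Expanding d_{m,i} = D_i - L_i, where D = d_{m+1} and L_i = X D_{i-1}, in
  -- c_{m,k} = Σᵢ d_{m,i} d_{m,k+i} gives four sums over the next level; those
  -- involving L are shifted sums of D.
  module _ (m : ℕ) where

    private
      X = x m
      D = d (suc m)
      L : ℕ → PS
      L i = X *ₚ d₋₁ (suc m) i
      c′ = c (suc m)

      pull : ∀ A k F → (∀ i → F i ≐ A *ₚ (D i *ₚ D (k ℕ.+ i))) → qsum F ≐ A *ₚ c′ k
      pull A k F F≐ = ≐-trans (qsum-cong F≐) (≐-sym (qsum-*ₚˡ A _ (Summable-c-terms (suc m) k)))

      L₀ : ∀ f → L 0 *ₚ f ≐ 0ₚ
      L₀ f = solve 2 (λ X f → (X :* con (+ 0)) :* f := con (+ 0)) ≐-refl X f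

    ΣLD : ∀ k → qsum (λ i → L i *ₚ D (k ℕ.+ i)) ≐ X *ₚ c′ (suc k)
    ΣLD k = ≐-trans
      (qsum-shift _ (λ i → q^∣-*ₚʳ (D (k ℕ.+ i)) (q^∣-x*d₋₁ m (suc m) i)) (L₀ (D (k ℕ.+ 0))))
      (pull X (suc k) _ (λ i → ≐-trans (*ₚ-congʳ (X *ₚ D i) (cong≐ D (ℕₚ.+-suc k i)))
        (solve 3 (λ X a b → (X :* a) :* b := X :* (a :* b)) ≐-refl X (D i) (D (suc k ℕ.+ i)))))

    ΣDL : ∀ k → qsum (λ i → D i *ₚ L (k ℕ.+ i)) ≐ X *ₚ neighbourSum c′ k -ₚ X *ₚ c′ (suc k)
    ΣDL zero = begin
        qsum (λ i → D i *ₚ L i)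
      ≈⟨ qsum-shift _ (λ i → q^∣-*ₚˡ (D i) (q^∣-x*d₋₁ m (suc m) i))
                      (≐-trans (*ₚ-comm (D 0) (L 0)) (L₀ (D 0))) ⟩
        qsum (λ i → D (suc i) *ₚ (X *ₚ D i))
      ≈⟨ pull X 1 _ (λ i → solve 3 (λ X a b → b :* (X :* a) := X :* (a :* b)) ≐-refl X (D i) (D (suc i))) ⟩
        X *ₚ c′ 1
      ≈⟨ solve 2 (λ X c → X :* c := X :* (c :+ c) :- X :* c) ≐-refl X (c′ 1) ⟩
        X *ₚ (c′ 1 +ₚ c′ 1) -ₚ X *ₚ c′ 1
      ∎
      where open ≐-Reasoning
    ΣDL (suc k) = begin
        qsum (λ i → D i *ₚ (X *ₚ D (k ℕ.+ i)))
      ≈⟨ pull X k _ (λ i → solve 3 (λ X a b → a :* (X :* b) := X :* (a :* b)) ≐-refl X (D i) (D (k ℕ.+ i))) ⟩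
        X *ₚ c′ k
      ≈⟨ solve 3 (λ X a b → X :* a := X :* (b :+ a) :- X :* b) ≐-refl X (c′ k) (c′ (suc (suc k))) ⟩
        X *ₚ (c′ (suc (suc k)) +ₚ c′ k) -ₚ X *ₚ c′ (suc (suc k))
      ∎
      where open ≐-Reasoning

    ΣLL : ∀ k → qsum (λ i → L i *ₚ L (k ℕ.+ i)) ≐ (X *ₚ X) *ₚ c′ k
    ΣLL k = ≐-trans
      (qsum-shift _ (λ i → q^∣-*ₚʳ (L (k ℕ.+ i)) (q^∣-x*d₋₁ m (suc m) i)) (L₀ (L (k ℕ.+ 0))))
      (≐-trans (qsum-cong (λ i → ≐-trans (*ₚ-congʳ (X *ₚ D i) (cong≐ L (ℕₚ.+-suc k i)))
                  (solve 3 (λ X a b → (X :* a) :* (X :* b) := (X :* X) :* (a :* b)) ≐-refl X (D i) (D (k ℕ.+ i)))))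
        (pull (X *ₚ X) k _ (λ i → ≐-refl)))

    c-step : ∀ k → c m k ≐ (1ₚ +ₚ X *ₚ X) *ₚ c′ k -ₚ X *ₚ neighbourSum c′ k
    c-step k = begin
        qsum (λ i → d m i *ₚ d m (k ℕ.+ i))
      ≈⟨ qsum-cong (λ i → ≐-trans (*ₚ-cong (d-step m i) (d-step m (k ℕ.+ i)))
           (solve 4 (λ a b u v → (a :- b) :* (u :- v) := (a :* u :+ b :* v) :- b :* u :- a :* v) ≐-refl
              (D i) (L i) (D (k ℕ.+ i)) (L (k ℕ.+ i)))) ⟩
        qsum (λ i → (D i *ₚ D (k ℕ.+ i) +ₚ L i *ₚ L (k ℕ.+ i)) -ₚ L i *ₚ D (k ℕ.+ i) -ₚ D i *ₚ L (k ℕ.+ i))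
      ≈⟨ ≐-trans (qsum-difference _ _)
           (-ₚ-cong (≐-trans (qsum-difference _ _) (-ₚ-cong (qsum-+ _ _) ≐-refl)) ≐-refl) ⟩
        (c′ k +ₚ qsum (λ i → L i *ₚ L (k ℕ.+ i))) -ₚ qsum (λ i → L i *ₚ D (k ℕ.+ i))
          -ₚ qsum (λ i → D i *ₚ L (k ℕ.+ i))
      ≈⟨ -ₚ-cong (-ₚ-cong (+ₚ-congʳ (c′ k) (ΣLL k)) (ΣLD k)) (ΣDL k) ⟩
        (c′ k +ₚ (X *ₚ X) *ₚ c′ k) -ₚ X *ₚ c′ (suc k) -ₚ (X *ₚ neighbourSum c′ k -ₚ X *ₚ c′ (suc k))
      ≈⟨ solve 4 (λ X c c₊ N → (c :+ (X :* X) :* c) :- X :* c₊ :- (X :* N :- X :* c₊)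
                               := (con (+ 1) :+ X :* X) :* c :- X :* N)
           ≐-refl X (c′ k) (c′ (suc k)) (neighbourSum c′ k) ⟩
        (1ₚ +ₚ X *ₚ X) *ₚ c′ k -ₚ X *ₚ neighbourSum c′ k
      ∎
      where open ≐-Reasoning

  U : ℕ → ℕ → PS
  U m j = weightedSum (λ k → B k j) (c m)

  U₋₁ : ℕ → ℕ → PS
  U₋₁ m j = weightedSum (λ k → Bprev k j) (c m)

  U-expansion : ∀ m j → U m j ≐ (1ₚ +ₚ x m *ₚ x m) *ₚ U (suc m) j
                               -ₚ x m *ₚ (constₚ (+ 2) *ₚ U (suc m) j +ₚ U₋₁ (suc m) j)
  U-expansion m j = begin
      qsum (λ k → natₚ (b k) *ₚ c m k)
    ≈⟨ qsum-cong (λ k → ≐-trans (*ₚ-congʳ (natₚ (b k)) (c-step m k))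
         (solve 4 (λ w A c N → w :* (A :* c :- N) := A :* (w :* c) :- w :* N) ≐-refl
            (natₚ (b k)) A (c′ k) (X *ₚ neighbourSum c′ k))) ⟩
      qsum (λ k → A *ₚ (natₚ (b k) *ₚ c′ k) -ₚ natₚ (b k) *ₚ (X *ₚ neighbourSum c′ k))
    ≈⟨ qsum-difference _ _ ⟩
      qsum (λ k → A *ₚ (natₚ (b k) *ₚ c′ k)) -ₚ qsum (λ k → natₚ (b k) *ₚ (X *ₚ neighbourSum c′ k))
    ≈⟨ -ₚ-cong (≐-sym (qsum-*ₚˡ A _ (Summable-weighted b c′ (Summable-c (suc m)))))
               (weightedSum-neighbourSum b c′ X (Summable-c (suc m)) (q^∣-x m)) ⟩
      A *ₚ U (suc m) j -ₚ X *ₚ weightedSum (neighbourSumᵀ b) c′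
    ≈⟨ -ₚ-cong (≐-refl {A *ₚ U (suc m) j})
         (*ₚ-congʳ X (weightedSum-linear _ b (λ k → Bprev k j) c′ (Summable-c (suc m)) (B-neighbourSumᵀ j))) ⟩
      A *ₚ U (suc m) j -ₚ X *ₚ (constₚ (+ 2) *ₚ U (suc m) j +ₚ U₋₁ (suc m) j)
    ∎
    where
    open ≐-Reasoning
    X  = x m
    A  = 1ₚ +ₚ X *ₚ X
    c′ = c (suc m)
    b : ℕ → ℕ
    b k = B k j

  U-step : ∀ m j → (1ₚ -ₚ x m) ^ₚ 2 *ₚ U (suc m) j ≐ U m j +ₚ x m *ₚ U₋₁ (suc m) j
  U-step m j = ≐-trans
    (solve 3 (λ X U V → (con (+ 1) :- X) :^ 2 :* U
                        := ((con (+ 1) :+ X :* X) :* U :- X :* (con (+ 2) :* U :+ V)) :+ X :* V)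
       ≐-refl (x m) (U (suc m) j) (U₋₁ (suc m) j))
    (+ₚ-congˡ _ (≐-sym (U-expansion m j)))

  d₀≐δ : ∀ a → d 0 a ≐ δ a
  d₀≐δ zero    = *ₚ-identityˡ 1ₚ
  d₀≐δ (suc a) = solve 1 (λ Y → con (+ 0) :* Y := con (+ 0)) ≐-refl (y ^ₚ suc a)

  c₀≐δ : ∀ k → c 0 k ≐ δ k
  c₀≐δ k = begin
      qsum (λ i → d 0 i *ₚ d 0 (k ℕ.+ i))
    ≈⟨ qsum-head _ (Summable-c-terms 0 k) ⟩
      d 0 0 *ₚ d 0 (k ℕ.+ 0) +ₚ qsum (λ i → d 0 (suc i) *ₚ d 0 (k ℕ.+ suc i))
    ≈⟨ +ₚ-cong (*ₚ-cong (d₀≐δ 0) (≐-trans (cong≐ (d 0) (ℕₚ.+-identityʳ k)) (d₀≐δ k)))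
               (qsum-zero _ (λ i → ≐-trans (*ₚ-congˡ (d 0 (k ℕ.+ suc i)) (d₀≐δ (suc i)))
                 (solve 1 (λ f → con (+ 0) :* f := con (+ 0)) ≐-refl (d 0 (k ℕ.+ suc i))))) ⟩
      1ₚ *ₚ δ k +ₚ 0ₚ
    ≈⟨ solve 1 (λ f → con (+ 1) :* f :+ con (+ 0) := f) ≐-refl (δ k) ⟩
      δ k
    ∎
    where open ≐-Reasoning

  U₀≐δ : ∀ j → U 0 j ≐ δ j
  U₀≐δ j = begin
      qsum (λ k → natₚ (B k j) *ₚ c 0 k)
    ≈⟨ qsum-head _ (Summable-weighted (λ k → B k j) (c 0) (Summable-c 0)) ⟩
      natₚ (B 0 j) *ₚ c 0 0 +ₚ qsum (λ k → natₚ (B (suc k) j) *ₚ c 0 (suc k))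
    ≈⟨ +ₚ-cong (*ₚ-congʳ (natₚ (B 0 j)) (c₀≐δ 0))
               (qsum-zero _ (λ k → ≐-trans (*ₚ-congʳ (natₚ (B (suc k) j)) (c₀≐δ (suc k)))
                 (solve 1 (λ f → f :* con (+ 0) := con (+ 0)) ≐-refl (natₚ (B (suc k) j))))) ⟩
      natₚ (B 0 j) *ₚ 1ₚ +ₚ 0ₚ
    ≈⟨ solve 1 (λ f → f :* con (+ 1) :+ con (+ 0) := f) ≐-refl (natₚ (B 0 j)) ⟩
      natₚ (B 0 j)
    ≈⟨ natₚ-B₀ j ⟩
      δ j
    ∎
    where
    open ≐-Reasoning
    natₚ-B₀ : ∀ j → natₚ (B 0 j) ≐ δ j
    natₚ-B₀ zero    zero    = refl
    natₚ-B₀ zero    (suc n) = refl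
    natₚ-B₀ (suc j) zero    = refl
    natₚ-B₀ (suc j) (suc n) = refl

  U₋₁-zero : ∀ m → U₋₁ m 0 ≐ 0ₚ
  U₋₁-zero m = qsum-zero _ (λ k → ≐-trans (*ₚ-congˡ (c m k) natₚ-zero)
    (solve 1 (λ f → con (+ 0) :* f := con (+ 0)) ≐-refl (c m k)))

  x/[1-x]² : ℕ → PS
  x/[1-x]² n = x n *ₚ inv ((1ₚ -ₚ x n) ^ₚ 2)

  P : ℕ → PS
  P m = qPoch y p m

  [1-x]²-invertible : ∀ n → (1ₚ -ₚ x n) ^ₚ 2 *ₚ inv ((1ₚ -ₚ x n) ^ₚ 2) ≐ 1ₚ
  [1-x]²-invertible n = *ₚ-inverseʳ ((1ₚ -ₚ x n) ^ₚ 2) constant-term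
    where
    constant-term : ((1ₚ -ₚ x n) ^ₚ 2) 0 ≡ + 1
    constant-term rewrite y₀ 0 (s≤s z≤n) = refl

  chainSum≐P²U : ∀ m j → chainSum (λ n → x/[1-x]² (n ∸ 1)) j m ≐ P m ^ₚ 2 *ₚ U m j
  chainSum≐P²U zero j = ≐-trans (chainSum-zero _ j)
    (≐-sym (≐-trans (*ₚ-congʳ (1ₚ ^ₚ 2) (U₀≐δ j)) (solve 1 (λ f → con (+ 1) :^ 2 :* f := f) ≐-refl (δ j))))
  chainSum≐P²U (suc m) zero = ≐-sym (begin
      (P m *ₚ a) ^ₚ 2 *ₚ U (suc m) 0
    ≈⟨ solve 3 (λ P a U → (P :* a) :^ 2 :* U := P :^ 2 :* (a :^ 2 :* U)) ≐-refl (P m) a (U (suc m) 0) ⟩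
      P m ^ₚ 2 *ₚ (a ^ₚ 2 *ₚ U (suc m) 0)
    ≈⟨ *ₚ-congʳ (P m ^ₚ 2) (≐-trans (U-step m 0) (+ₚ-congʳ (U m 0) (*ₚ-congʳ (x m) (U₋₁-zero (suc m))))) ⟩
      P m ^ₚ 2 *ₚ (U m 0 +ₚ x m *ₚ 0ₚ)
    ≈⟨ solve 3 (λ P U X → P :* (U :+ X :* con (+ 0)) := P :* U) ≐-refl (P m ^ₚ 2) (U m 0) (x m) ⟩
      P m ^ₚ 2 *ₚ U m 0
    ≈⟨ ≐-sym (chainSum≐P²U m 0) ⟩
      1ₚ
    ∎)
    where
    open ≐-Reasoning
    a = 1ₚ -ₚ x m
  chainSum≐P²U (suc m) (suc j) = begin
      chainSum t (suc j) m +ₚ x/[1-x]² m *ₚ chainSum t j (suc m)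
    ≈⟨ +ₚ-cong (chainSum≐P²U m (suc j)) (*ₚ-congʳ (x/[1-x]² m) (chainSum≐P²U (suc m) j)) ⟩
      P m ^ₚ 2 *ₚ U m (suc j) +ₚ (X *ₚ I) *ₚ ((P m *ₚ a) ^ₚ 2 *ₚ U′)
    ≈⟨ solve 6 (λ P a X I V U → P :^ 2 :* V :+ (X :* I) :* ((P :* a) :^ 2 :* U)
                               := P :^ 2 :* (V :+ X :* U) :+ (a :^ 2 :* I :- con (+ 1)) :* (X :* P :^ 2 :* U))
         ≐-refl (P m) a X I (U m (suc j)) U′ ⟩
      P m ^ₚ 2 *ₚ (U m (suc j) +ₚ X *ₚ U′) +ₚ (a ^ₚ 2 *ₚ I -ₚ 1ₚ) *ₚ (X *ₚ P m ^ₚ 2 *ₚ U′)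
    ≈⟨ +ₚ-cong (*ₚ-congʳ (P m ^ₚ 2) (≐-sym (U-step m (suc j))))
               (*ₚ-congˡ (X *ₚ P m ^ₚ 2 *ₚ U′) (-ₚ-cong ([1-x]²-invertible m) (≐-refl {1ₚ}))) ⟩
      P m ^ₚ 2 *ₚ (a ^ₚ 2 *ₚ U (suc m) (suc j)) +ₚ (1ₚ -ₚ 1ₚ) *ₚ (X *ₚ P m ^ₚ 2 *ₚ U′)
    ≈⟨ solve 4 (λ P a U W → P :^ 2 :* (a :^ 2 :* U) :+ (con (+ 1) :- con (+ 1)) :* W := (P :* a) :^ 2 :* U)
         ≐-refl (P m) a (U (suc m) (suc j)) (X *ₚ P m ^ₚ 2 *ₚ U′) ⟩
      (P m *ₚ a) ^ₚ 2 *ₚ U (suc m) (suc j)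
    ∎
    where
    open ≐-Reasoning
    t : ℕ → PS
    t n = x/[1-x]² (n ∸ 1)
    X = x m
    a = 1ₚ -ₚ X
    I = inv (a ^ₚ 2)
    U′ = U (suc m) j

sign-square : ∀ {ε} → ε ≡ + 1 ⊎ ε ≡ - (+ 1) → ε * ε ≡ + 1
sign-square (inj₁ refl) = refl
sign-square (inj₂ refl) = refl

module Signed (ε : ℤ) (ε*ε≡1 : ε * ε ≡ + 1) where

  ε^n*ε^n≡1 : ∀ n → ε ^ n * ε ^ n ≡ + 1
  ε^n*ε^n≡1 zero    = refl
  ε^n*ε^n≡1 (suc n) = trans (interchange ε (ε ^ n)) (cong₂ _*_ ε*ε≡1 (ε^n*ε^n≡1 n))
    where
    interchange : ∀ a b → (a * b) * (a * b) ≡ (a * a) * (b * b)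
    interchange = ℤ-Solver.solve-∀

  ε^[i]*ε^[k+i]≡ε^k : ∀ k i → ε ^ i * ε ^ (k ℕ.+ i) ≡ ε ^ k
  ε^[i]*ε^[k+i]≡ε^k k i = begin
    ε ^ i * ε ^ (k ℕ.+ i)          ≡⟨ cong (ε ^ i *_) (ℤₚ.^-distribˡ-+-* ε k i) ⟩
    ε ^ i * (ε ^ k * ε ^ i)        ≡⟨ rearrange (ε ^ i) (ε ^ k) ⟩
    ε ^ k * (ε ^ i * ε ^ i)        ≡⟨ cong (ε ^ k *_) (ε^n*ε^n≡1 i) ⟩
    ε ^ k * + 1                    ≡⟨ ℤₚ.*-identityʳ (ε ^ k) ⟩
    ε ^ k                          ∎
    where
    open ≡-Reasoning
    rearrange : ∀ a b → a * (b * a) ≡ b * (a * a)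
    rearrange = ℤ-Solver.solve-∀

  ε^[k∸j]≡ε^j*ε^k : ∀ j k → j ≤ k → ε ^ (k ∸ j) ≡ ε ^ j * ε ^ k
  ε^[k∸j]≡ε^j*ε^k j k j≤k = begin
    ε ^ (k ∸ j)                    ≡⟨ sym (ε^[i]*ε^[k+i]≡ε^k (k ∸ j) j) ⟩
    ε ^ j * ε ^ (k ∸ j ℕ.+ j)      ≡⟨ cong (λ n → ε ^ j * ε ^ n) (ℕₚ.m∸n+n≡m j≤k) ⟩
    ε ^ j * ε ^ k                  ∎
    where open ≡-Reasoning

  y : PS
  y = scale ε q

  y₀ : q^ 1 ∣ y
  y₀ = q^∣-scale ε q q^1∣q

  y^≐ : ∀ a → y ^ₚ a ≐ constₚ (ε ^ a) *ₚ q ^ₚ a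
  y^≐ a = ≐-trans (^ₚ-cong a (≐-sym (constₚ-*ₚ ε q)))
    (≐-trans (^ₚ-distrib-*ₚ (constₚ ε) q a) (*ₚ-congˡ (q ^ₚ a) (constₚ-^ₚ ε a)))

  module _ (p : PS) (p₀ : q^ 1 ∣ p) where

    open Core p y p₀ y₀

    c≐H : ∀ m₀ k → c (suc m₀) k ≐ constₚ (ε ^ k) *ₚ (mono k *ₚ H k (suc m₀) p (q ^ₚ 2))
    c≐H m₀ k = ≐-sym (begin
        constₚ (ε ^ k) *ₚ (mono k *ₚ qsum F)
      ≈⟨ *ₚ-congʳ (constₚ (ε ^ k)) (qsum-*ₚˡ (mono k) F summable-F) ⟩
        constₚ (ε ^ k) *ₚ qsum (λ i → mono k *ₚ F i)
      ≈⟨ qsum-*ₚˡ (constₚ (ε ^ k)) _ (λ i → q^∣-*ₚˡ (mono k) (summable-F i)) ⟩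
        qsum (λ i → constₚ (ε ^ k) *ₚ (mono k *ₚ F i))
      ≈⟨ qsum-cong term ⟩
        qsum (λ i → d (suc m₀) i *ₚ d (suc m₀) (k ℕ.+ i))
      ∎)
      where
      open ≐-Reasoning
      F : ℕ → PS
      F i = gauss p (m₀ ℕ.+ i) i *ₚ gauss p (m₀ ℕ.+ k ℕ.+ i) (k ℕ.+ i) *ₚ (q ^ₚ 2) ^ₚ i
      summable-F : Summable F
      summable-F i = q^∣-*ₚˡ (gauss p (m₀ ℕ.+ i) i *ₚ gauss p (m₀ ℕ.+ k ℕ.+ i) (k ℕ.+ i))
                              (q^∣-^ₚ i q^1∣q²)
      [q²]^i : ∀ i → (q ^ₚ 2) ^ₚ i ≐ q ^ₚ i *ₚ q ^ₚ i
      [q²]^i i = ≐-trans (^ₚ-* q 2 i)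
        (≐-trans (^ₚ-+ q i (i ℕ.+ 0)) (*ₚ-congʳ (q ^ₚ i) (cong≐ (q ^ₚ_) (ℕₚ.+-identityʳ i))))
      term : ∀ i → constₚ (ε ^ k) *ₚ (mono k *ₚ F i) ≐ d (suc m₀) i *ₚ d (suc m₀) (k ℕ.+ i)
      term i = begin
          constₚ (ε ^ k) *ₚ (mono k *ₚ (G₁ *ₚ gauss p (m₀ ℕ.+ k ℕ.+ i) (k ℕ.+ i) *ₚ (q ^ₚ 2) ^ₚ i))
        ≈⟨ *ₚ-cong (cong≐ constₚ (sym (ε^[i]*ε^[k+i]≡ε^k k i)))
             (*ₚ-cong (mono≐q^ k) (*ₚ-cong (*ₚ-congʳ G₁ (cong≐ (λ n → gauss p n (k ℕ.+ i)) (ℕₚ.+-assoc m₀ k i)))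
                                           ([q²]^i i))) ⟩
          constₚ (ε ^ i * ε ^ (k ℕ.+ i)) *ₚ (q ^ₚ k *ₚ (G₁ *ₚ G₂ *ₚ (q ^ₚ i *ₚ q ^ₚ i)))
        ≈⟨ *ₚ-congˡ (q ^ₚ k *ₚ (G₁ *ₚ G₂ *ₚ (q ^ₚ i *ₚ q ^ₚ i))) (constₚ-* (ε ^ i) (ε ^ (k ℕ.+ i))) ⟩
          (constₚ (ε ^ i) *ₚ constₚ (ε ^ (k ℕ.+ i))) *ₚ (q ^ₚ k *ₚ (G₁ *ₚ G₂ *ₚ (q ^ₚ i *ₚ q ^ₚ i)))
        ≈⟨ solve 6 (λ eᵢ eₖᵢ qₖ G₁ G₂ qᵢ → (eᵢ :* eₖᵢ) :* (qₖ :* (G₁ :* G₂ :* (qᵢ :* qᵢ)))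
                                          := (G₁ :* (eᵢ :* qᵢ)) :* (G₂ :* (eₖᵢ :* (qₖ :* qᵢ))))
             ≐-refl (constₚ (ε ^ i)) (constₚ (ε ^ (k ℕ.+ i))) (q ^ₚ k) G₁ G₂ (q ^ₚ i) ⟩
          (G₁ *ₚ (constₚ (ε ^ i) *ₚ q ^ₚ i)) *ₚ (G₂ *ₚ (constₚ (ε ^ (k ℕ.+ i)) *ₚ (q ^ₚ k *ₚ q ^ₚ i)))
        ≈⟨ *ₚ-cong (*ₚ-congʳ G₁ (≐-sym (y^≐ i)))
                   (*ₚ-congʳ G₂ (≐-trans (*ₚ-congʳ (constₚ (ε ^ (k ℕ.+ i))) (≐-sym (^ₚ-+ q k i)))
                                         (≐-sym (y^≐ (k ℕ.+ i))))) ⟩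
          (G₁ *ₚ y ^ₚ i) *ₚ (G₂ *ₚ y ^ₚ (k ℕ.+ i))
        ∎
        where
        G₁ = gauss p (m₀ ℕ.+ i) i
        G₂ = gauss p (m₀ ℕ.+ (k ℕ.+ i)) (k ℕ.+ i)

    Sser≐U : ∀ j m₀ → Sser ε j (suc m₀) p (q ^ₚ 2) ≐ scale (ε ^ j) (U (suc m₀) j)
    Sser≐U j m₀ = ≐-trans (qsum-cong term) (qsum-scale (ε ^ j) (λ k → natₚ (B k j) *ₚ c (suc m₀) k))
      where
      M : ℕ → PS
      M k = mono k *ₚ H k (suc m₀) p (q ^ₚ 2)
      term : ∀ k → (if j ≤ᵇ k then scale (ε ^ (k ∸ j) * + B k j) (M k) else 0ₚ)
                 ≐ scale (ε ^ j) (natₚ (B k j) *ₚ c (suc m₀) k)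
      term k with j ≤ᵇ k in j≤ᵇk
      ... | true = begin
          scale (ε ^ (k ∸ j) * + B k j) (M k)
        ≈⟨ ≐-sym (constₚ-*ₚ (ε ^ (k ∸ j) * + B k j) (M k)) ⟩
          constₚ (ε ^ (k ∸ j) * + B k j) *ₚ M k
        ≈⟨ *ₚ-congˡ (M k) (≐-trans (cong≐ (λ e → constₚ (e * + B k j)) (ε^[k∸j]≡ε^j*ε^k j k j≤k))
                                   (≐-trans (constₚ-* (ε ^ j * ε ^ k) (+ B k j))
                                            (*ₚ-congˡ (natₚ (B k j)) (constₚ-* (ε ^ j) (ε ^ k))))) ⟩
          constₚ (ε ^ j) *ₚ constₚ (ε ^ k) *ₚ natₚ (B k j) *ₚ M k
        ≈⟨ solve 4 (λ eʲ eᵏ b M → eʲ :* eᵏ :* b :* M := eʲ :* (b :* (eᵏ :* M))) ≐-refl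
             (constₚ (ε ^ j)) (constₚ (ε ^ k)) (natₚ (B k j)) (M k) ⟩
          constₚ (ε ^ j) *ₚ (natₚ (B k j) *ₚ (constₚ (ε ^ k) *ₚ M k))
        ≈⟨ ≐-trans (*ₚ-congʳ (constₚ (ε ^ j)) (*ₚ-congʳ (natₚ (B k j)) (≐-sym (c≐H m₀ k))))
                   (constₚ-*ₚ (ε ^ j) (natₚ (B k j) *ₚ c (suc m₀) k)) ⟩
          scale (ε ^ j) (natₚ (B k j) *ₚ c (suc m₀) k)
        ∎
        where
        open ≐-Reasoning
        j≤k = ℕₚ.≤ᵇ⇒≤ j k (subst Bool.T (sym j≤ᵇk) _)
      ... | false = λ n → sym (trans (cong (ε ^ j *_) (vanishing n)) (ℤₚ.*-zeroʳ (ε ^ j)))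
        where
        k<j : k < j
        k<j = ℕₚ.≰⇒> (λ j≤k → subst Bool.T j≤ᵇk (ℕₚ.≤⇒≤ᵇ j≤k))
        vanishing : natₚ (B k j) *ₚ c (suc m₀) k ≐ 0ₚ
        vanishing = ≐-trans (*ₚ-congˡ (c (suc m₀) k) (≐-trans (cong≐ natₚ (B-vanishes k<j)) natₚ-zero))
                            (solve 1 (λ f → con (+ 0) :* f := con (+ 0)) ≐-refl (c (suc m₀) k))

    term≐x/[1-x]² : ∀ n t → t ≐ q *ₚ p ^ₚ n → t *ₚ inv ((1ₚ -ₚ scale ε t) ^ₚ 2) ≐ constₚ ε *ₚ x/[1-x]² n
    term≐x/[1-x]² n t t≐ = ≐-trans (*ₚ-cong t≐εx (inv-cong (^ₚ-cong 2 (-ₚ-cong (≐-refl {1ₚ}) εt≐x))))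
                            (*ₚ-assoc (constₚ ε) (x n) (inv ((1ₚ -ₚ x n) ^ₚ 2)))
      where
      εt≐x : scale ε t ≐ x n
      εt≐x = ≐-trans (≐-sym (constₚ-*ₚ ε t)) (≐-trans (*ₚ-congʳ (constₚ ε) t≐)
        (≐-trans (≐-sym (*ₚ-assoc (constₚ ε) q (p ^ₚ n))) (*ₚ-congˡ (p ^ₚ n) (constₚ-*ₚ ε q))))
      εε≐1 : constₚ ε *ₚ constₚ ε ≐ 1ₚ
      εε≐1 = ≐-trans (≐-sym (constₚ-* ε ε)) (≐-trans (cong≐ constₚ ε*ε≡1) constₚ-1)
      t≐εx : t ≐ constₚ ε *ₚ x n
      t≐εx = begin
          t
        ≈⟨ t≐ ⟩
          q *ₚ p ^ₚ n
        ≈⟨ solve 3 (λ e q P → q :* P := e :* (e :* q :* P) :+ (con (+ 1) :- e :* e) :* (q :* P))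
             ≐-refl (constₚ ε) q (p ^ₚ n) ⟩
          constₚ ε *ₚ (constₚ ε *ₚ q *ₚ p ^ₚ n) +ₚ (1ₚ -ₚ constₚ ε *ₚ constₚ ε) *ₚ (q *ₚ p ^ₚ n)
        ≈⟨ +ₚ-cong (*ₚ-congʳ (constₚ ε) (*ₚ-congˡ (p ^ₚ n) (constₚ-*ₚ ε q)))
                   (*ₚ-congˡ (q *ₚ p ^ₚ n) (-ₚ-cong (≐-refl {1ₚ}) εε≐1)) ⟩
          constₚ ε *ₚ x n +ₚ (1ₚ -ₚ 1ₚ) *ₚ (q *ₚ p ^ₚ n)
        ≈⟨ solve 2 (λ a b → a :+ (con (+ 1) :- con (+ 1)) :* b := a) ≐-refl (constₚ ε *ₚ x n) (q *ₚ p ^ₚ n) ⟩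
          constₚ ε *ₚ x n
        ∎
        where open ≐-Reasoning

    chainSum-identity : ∀ t → (∀ n → t (suc n) ≐ constₚ ε *ₚ x/[1-x]² n) → ∀ j m₀ →
      chainSum t j (suc m₀) ≐ qPoch y p (suc m₀) ^ₚ 2 *ₚ Sser ε j (suc m₀) p (q ^ₚ 2)
    chainSum-identity t t≐ j m₀ = begin
        chainSum t j (suc m₀)
      ≈⟨ chainSum-scale ε t≐ j (suc m₀) ⟩
        constₚ (ε ^ j) *ₚ chainSum (λ n → x/[1-x]² (n ∸ 1)) j (suc m₀)
      ≈⟨ *ₚ-congʳ (constₚ (ε ^ j)) (chainSum≐P²U (suc m₀) j) ⟩
        constₚ (ε ^ j) *ₚ (P (suc m₀) ^ₚ 2 *ₚ U (suc m₀) j)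
      ≈⟨ solve 3 (λ e P U → e :* (P :^ 2 :* U) := P :^ 2 :* (e :* U)) ≐-refl
           (constₚ (ε ^ j)) (P (suc m₀)) (U (suc m₀) j) ⟩
        P (suc m₀) ^ₚ 2 *ₚ (constₚ (ε ^ j) *ₚ U (suc m₀) j)
      ≈⟨ *ₚ-congʳ (P (suc m₀) ^ₚ 2) (≐-trans (constₚ-*ₚ (ε ^ j) (U (suc m₀) j)) (≐-sym (Sser≐U j m₀))) ⟩
        P (suc m₀) ^ₚ 2 *ₚ Sser ε j (suc m₀) p (q ^ₚ 2)
      ∎
      where open ≐-Reasoning

  V-identity : ∀ j m₀ → V ε j (suc m₀) ≐ qPoch y q (suc m₀) ^ₚ 2 *ₚ Sser ε j (suc m₀) q (q ^ₚ 2)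
  V-identity j m₀ = ≐-trans (V≐chainSum ε j (suc m₀))
    (chainSum-identity q q^1∣q (Vterm ε)
       (λ n → term≐x/[1-x]² q q^1∣q n (mono (suc n)) (mono≐q^ (suc n))) j m₀)

  W-identity : ∀ j m₀ → W ε j (suc m₀) ≐ qPoch y (q ^ₚ 2) (suc m₀) ^ₚ 2 *ₚ Sser ε j (suc m₀) (q ^ₚ 2) (q ^ₚ 2)
  W-identity j m₀ = ≐-trans (W≐chainSum ε j (suc m₀))
    (chainSum-identity (q ^ₚ 2) q^1∣q² (Wterm ε)
       (λ n → term≐x/[1-x]² (q ^ₚ 2) q^1∣q² n (mono (2 ℕ.* suc n ∸ 1)) (mono-odd n)) j m₀)

theorem2 : (j m : ℕ) → 1 ≤ m → (ε : ℤ) → (ε ≡ + 1 ⊎ ε ≡ - (+ 1)) →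
    (V ε j m ≐ (qPoch (scale ε q) q m ^ₚ 2) *ₚ Sser ε j m q (q ^ₚ 2))
    × (W ε j m ≐ (qPoch (scale ε q) (q ^ₚ 2) m ^ₚ 2) *ₚ Sser ε j m (q ^ₚ 2) (q ^ₚ 2))
theorem2 j (suc m₀) (s≤s z≤n) ε ε≡±1 = V-identity j m₀ , W-identity j m₀
  where open Signed ε (sign-square ε≡±1)
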